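{- Let $G$ be a connected graph with $n$ vertices and $m$ edges, and let $p\geq 4$ be the length (number of edges) of a longest path in $G$. If $p$ is even, then \[ m- \left\lfloor \frac{(p-2)n+2}{p-1}\right\rfloor \leq \nabla(L(G))\leq m-p; \] if $p$ is odd, then \[ m-\left\lfloor \frac{(p-3)n+4}{p-2}\right\rfloor \leq \nabla(L(G))\leq m-p. \]
   Context: $L(G)$ is the line graph of $G$ (vertices are the edges of $G$, adjacent iff they share an endpoint). For a graph $H$, $\nabla(H)$ (the decycling number) is the minimum number of vertices whose removal from $H$ leaves an acyclic graph. Paths are simple paths. -}

module Defs where

open import Data.Nat using (ℕ; zero; suc; _≤_; _<ᵇ_; _/_)
open import Data.Fin using (Fin; toℕ)
open import Data.List using (List; []; _∷_; [_]; length; concatMap; allFin; lookup; _++_; take)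
open import Data.List.Relation.Unary.All using (All)
open import Data.List.Relation.Unary.Unique.Propositional using (Unique)
open import Data.List.Relation.Unary.Linked using (Linked)
open import Data.List.Membership.Propositional using (_∉_)
open import Data.Bool using (Bool; true; false; if_then_else_; _∧_)
open import Data.Product using (Σ; _×_; _,_)
open import Data.Sum using (_⊎_)
open import Relation.Binary.PropositionalEquality using (_≡_; _≢_)
open import Relation.Binary.Construct.Closure.ReflexiveTransitive using (Star)
open import Relation.Nullary using (¬_)

record Graph : Set₁ where
  field
    V   : Set
    Adj : V → V → Set
open Graph public

record SimpleGraph (n : ℕ) : Set where
  field
    adj    : Fin n → Fin n → Bool
    sym    : ∀ i j → adj i j ≡ adj j i
    irrefl : ∀ i → adj i i ≡ false
open SimpleGraph public

toGraph : ∀ {n} → SimpleGraph n → Graph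
toGraph {n} G = record { V = Fin n ; Adj = λ i j → adj G i j ≡ true }

edges : ∀ {n} → SimpleGraph n → List (Fin n × Fin n)
edges {n} G =
  concatMap (λ i → concatMap (λ j →
    if (toℕ i <ᵇ toℕ j) ∧ adj G i j then [ (i , j) ] else []) (allFin n)) (allFin n)

numEdges : ∀ {n} → SimpleGraph n → ℕ
numEdges G = length (edges G)

ShareEndpoint : ∀ {n} → Fin n × Fin n → Fin n × Fin n → Set
ShareEndpoint (a , b) (c , d) = (a ≡ c ⊎ a ≡ d) ⊎ (b ≡ c ⊎ b ≡ d)

LineGraph : ∀ {n} → SimpleGraph n → Graph
LineGraph G = record
  { V   = Fin (numEdges G)
  ; Adj = λ k l → k ≢ l × ShareEndpoint (lookup (edges G) k) (lookup (edges G) l) }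

IsPath : (H : Graph) → List (V H) → ℕ → Set
IsPath H xs p = length xs ≡ suc p × Unique xs × Linked (Adj H) xs

LongestPathLength : Graph → ℕ → Set
LongestPathLength H p =
  Σ (List (V H)) (λ xs → IsPath H xs p) ×
  (∀ (xs : List (V H)) (q : ℕ) → IsPath H xs q → q ≤ p)

Connected : Graph → Set
Connected H = ∀ u v → Star (Adj H) u v

-- A cycle: at least 3 distinct vertices v₀ … v_{k-1}, consecutive ones adjacent
-- and v_{k-1} adjacent to v₀.
IsCycle : (H : Graph) → List (V H) → Set
IsCycle H xs = 3 ≤ length xs × Unique xs × Linked (Adj H) (xs ++ take 1 xs)

-- H - S is acyclic: no cycle of H avoids all vertices of S
-- (cycles of the induced subgraph H - S are exactly the cycles of H inside V∖S).
Acyclic-without : (H : Graph) → List (V H) → Set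
Acyclic-without H S = ¬ Σ (List (V H)) (λ xs → IsCycle H xs × All (_∉ S) xs)

IsDecyclingSet : (H : Graph) → List (V H) → Set
IsDecyclingSet H S = Unique S × Acyclic-without H S

IsDecyclingNumber : Graph → ℕ → Set
IsDecyclingNumber H d =
  Σ (List (V H)) (λ S → IsDecyclingSet H S × length S ≡ d) ×
  (∀ S → IsDecyclingSet H S → d ≤ length S)

-- floor division (a / 0 := 0; only used with positive divisors)
floorDiv : ℕ → ℕ → ℕ
floorDiv a zero = 0
floorDiv a (suc b) = a / suc b

-- If S is a decycling set of L(G), the edges outside S span a linear forest of G: a vertex meeting
-- three of them would give a triangle of L(G), and a cycle of G a cycle of L(G).  These edges thus
-- form k vertex-disjoint paths covering all n vertices, with n − k edges, so m ≤ |S| + n − k.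
-- As G is connected, two of these paths are joined by a path meeting them only at its ends, and
-- gluing the longer halves of both to it gives a path of G, hence of at most p + 1 vertices.  For p
-- even, at most one component has p or more vertices; for p odd, at most two have p − 1 or more
-- (of three such, two are joined through a further vertex), and those have at most p.  Counting
-- vertices gives n ≤ (p − 1)k + 2, resp. n ≤ (p − 2)k + 4, which rearranges to the lower bounds.
-- For the upper bound, the p edges of a longest path induce a path in L(G), so the other m − p
-- edges form a decycling set.

module Submission where

open import Defs hiding (V) renaming (sym to adj-sym)
open import Data.Nat using (ℕ; zero; suc; _≤_; _<_; _+_; _*_; _∸_; z≤n; s≤s; _≤?_; _<?_; _<ᵇ_; _/_)
open import Data.Nat.Properties
open import Data.Nat.Divisibility using (_∣_; divides)
open import Data.Nat.DivMod using (m*n/n≡m; /-monoˡ-≤)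
open import Data.Nat.ListAction using (sum)
open import Data.Nat.Tactic.RingSolver using (solve-∀)
open import Data.Product using (Σ; _×_; _,_; proj₁; proj₂)
open import Data.Sum using (_⊎_; inj₁; inj₂; [_,_]′)
open import Data.Empty using (⊥; ⊥-elim)
open import Data.Unit using (⊤; tt)
open import Data.Bool using (true; false; if_then_else_; _∧_; T)
open import Data.Maybe using (just)
open import Data.Fin using (Fin; toℕ) renaming (_≟_ to _≟F_)
import Data.Fin as Fin
import Data.Fin.Properties as FP
open import Data.List using (List; []; _∷_; [_]; _++_; length; concatMap; concat; map; allFin; lookup; take; filter; last; reverse; initLast; _∷ʳ′_)
open import Data.List.Properties using (++-assoc; ++-identityʳ; length-++; length-++-sucʳ; length-++-comm; length-map; length-tabulate; length-reverse; unfold-reverse; reverse-++; ∷ʳ-injective)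
open import Data.List.Relation.Unary.All as All using (All; []; _∷_)
import Data.List.Relation.Unary.All.Properties as AllP
open import Data.List.Relation.Unary.Any as Any using (Any; here; there)
import Data.List.Relation.Unary.Any.Properties as AnyP
open import Data.List.Relation.Unary.AllPairs as AP using (AllPairs; []; _∷_)
import Data.List.Relation.Unary.AllPairs.Properties as APP
open import Data.List.Relation.Unary.Linked as Lk using (Linked; []; [-]; _∷_)
open import Data.List.Relation.Unary.Unique.Propositional using (Unique)
import Data.List.Relation.Unary.Unique.Propositional.Properties as UP
open import Data.List.Relation.Unary.Unique.Propositional.Properties using (Unique[x∷xs]⇒x∉xs)
open import Data.List.Relation.Binary.Disjoint.Propositional using (Disjoint)
open import Data.List.Relation.Binary.Disjoint.Propositional.Properties using () renaming (sym to Disjoint-sym)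
open import Data.List.Relation.Binary.Subset.Propositional using (_⊆_)
open import Data.List.Membership.Propositional using (_∈_; _∉_; find; lose)
open import Data.List.Membership.Propositional.Properties
open import Relation.Binary.PropositionalEquality hiding ([_])
open import Relation.Binary.Definitions using (DecidableEquality; Symmetric; tri<; tri≈; tri>)
open import Relation.Binary.Construct.Closure.ReflexiveTransitive using (Star; ε; _◅_)
open import Relation.Nullary
open import Relation.Nullary.Decidable using (_×-dec_; _⊎-dec_; ¬?; decidable-stable)
open import Function using (_∘_)
open import Relation.Unary using (_∪_)

module _ {A : Set} where

  Unique-tail : ∀ {x : A} {xs} → Unique (x ∷ xs) → Unique xs
  Unique-tail (_ ∷ u) = u

  Unique-∷⁺ : ∀ {x : A} {xs} → x ∉ xs → Unique xs → Unique (x ∷ xs)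
  Unique-∷⁺ {xs = xs} x∉ u = AllP.¬Any⇒All¬ xs x∉ ∷ u

  Unique-++⁻ˡ : ∀ (xs : List A) {ys} → Unique (xs ++ ys) → Unique xs
  Unique-++⁻ˡ [] u = []
  Unique-++⁻ˡ (x ∷ xs) (x∉ ∷ u) = AllP.++⁻ˡ xs x∉ ∷ Unique-++⁻ˡ xs u

  Unique-++⁻ʳ : ∀ (xs : List A) {ys} → Unique (xs ++ ys) → Unique ys
  Unique-++⁻ʳ [] u = u
  Unique-++⁻ʳ (x ∷ xs) (_ ∷ u) = Unique-++⁻ʳ xs u

  Unique-++⇒Disjoint : ∀ (xs : List A) {ys} → Unique (xs ++ ys) → Disjoint xs ys
  Unique-++⇒Disjoint [] _ (() , _)
  Unique-++⇒Disjoint (x ∷ xs) u (here refl , v∈ys) = Unique[x∷xs]⇒x∉xs u (∈-++⁺ʳ xs v∈ys)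
  Unique-++⇒Disjoint (x ∷ xs) (_ ∷ u) (there v∈xs , v∈ys) = Unique-++⇒Disjoint xs u (v∈xs , v∈ys)

  Unique-++-comm : ∀ (xs : List A) {ys} → Unique (xs ++ ys) → Unique (ys ++ xs)
  Unique-++-comm xs u =
    UP.++⁺ (Unique-++⁻ʳ xs u) (Unique-++⁻ˡ xs u) (Disjoint-sym (Unique-++⇒Disjoint xs u))

  Disjoint-⊆∪ : ∀ {xs ys zs ws : List A} → (∀ {v} → v ∈ ws → v ∈ xs ⊎ v ∈ ys) →
                Disjoint xs zs → Disjoint ys zs → Disjoint ws zs
  Disjoint-⊆∪ ws⊆ xs#zs ys#zs (v∈ws , v∈zs) =
    [ (λ v∈xs → xs#zs (v∈xs , v∈zs)) , (λ v∈ys → ys#zs (v∈ys , v∈zs)) ]′ (ws⊆ v∈ws)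

  Unique-⊆⇒length≤ : ∀ {xs ys : List A} → Unique xs → xs ⊆ ys → length xs ≤ length ys
  Unique-⊆⇒length≤ {[]} _ _ = z≤n
  Unique-⊆⇒length≤ {x ∷ xs} {ys} u xs⊆ys with ∈-∃++ (xs⊆ys (here refl))
  ... | ys₁ , ys₂ , refl =
    ≤-trans (s≤s (Unique-⊆⇒length≤ (Unique-tail u) xs⊆ys₁++ys₂))
            (≤-reflexive (sym (length-++-sucʳ ys₁ x ys₂)))
    where
    remove : ∀ zs {v} → v ∈ zs ++ x ∷ ys₂ → v ≢ x → v ∈ zs ++ ys₂
    remove [] (here v≡x) v≢x = ⊥-elim (v≢x v≡x)
    remove [] (there v∈) _ = v∈
    remove (z ∷ zs) (here v≡z) _ = here v≡z
    remove (z ∷ zs) (there v∈) v≢x = there (remove zs v∈ v≢x)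
    xs⊆ys₁++ys₂ : xs ⊆ ys₁ ++ ys₂
    xs⊆ys₁++ys₂ v∈ = remove ys₁ (xs⊆ys (there v∈)) (λ { refl → Unique[x∷xs]⇒x∉xs u v∈ })

  reverse-∷ʳ : ∀ (xs : List A) x → reverse (xs ++ [ x ]) ≡ x ∷ reverse xs
  reverse-∷ʳ xs x = reverse-++ xs [ x ]

  Unique-reverse⁺ : ∀ {xs : List A} → Unique xs → Unique (reverse xs)
  Unique-reverse⁺ {[]} u = []
  Unique-reverse⁺ {x ∷ xs} u = subst Unique (sym (unfold-reverse x xs))
    (UP.++⁺ (Unique-reverse⁺ (Unique-tail u)) ([] ∷ [])
       λ { (x∈ , here refl) → Unique[x∷xs]⇒x∉xs u (AnyP.reverse⁻ x∈) })

  last-∷ʳ : ∀ (xs : List A) a → last (xs ++ [ a ]) ≡ just a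
  last-∷ʳ [] a = refl
  last-∷ʳ (x ∷ []) a = refl
  last-∷ʳ (x ∷ y ∷ xs) a = last-∷ʳ (y ∷ xs) a

  length-concat : ∀ (xss : List (List A)) → length (concat xss) ≡ sum (map length xss)
  length-concat [] = refl
  length-concat (xs ∷ xss) = trans (length-++ xs) (cong (length xs +_) (length-concat xss))

  length-filter+filter¬ : {P : A → Set} (P? : ∀ x → Dec (P x)) (xs : List A) →
    length (filter P? xs) + length (filter (λ x → ¬? (P? x)) xs) ≡ length xs
  length-filter+filter¬ P? [] = refl
  length-filter+filter¬ P? (x ∷ xs) with P? x
  ... | yes _ = cong suc (length-filter+filter¬ P? xs)
  ... | no _ = trans (+-suc _ _) (cong suc (length-filter+filter¬ P? xs))

  module _ {R : A → A → Set} where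

    Linked-++⁻ˡ : ∀ (xs : List A) {ys} → Linked R (xs ++ ys) → Linked R xs
    Linked-++⁻ˡ [] l = []
    Linked-++⁻ˡ (x ∷ []) l = [-]
    Linked-++⁻ˡ (x ∷ y ∷ xs) (r ∷ l) = r ∷ Linked-++⁻ˡ (y ∷ xs) l

    Linked-++⁻ʳ : ∀ (xs : List A) {ys} → Linked R (xs ++ ys) → Linked R ys
    Linked-++⁻ʳ [] l = l
    Linked-++⁻ʳ (x ∷ xs) l = Linked-++⁻ʳ xs (Lk.tail l)

    Linked-join : ∀ (xs : List A) {a ys} → Linked R (xs ++ [ a ]) → Linked R (a ∷ ys) → Linked R (xs ++ a ∷ ys)
    Linked-join [] _ l = l
    Linked-join (x ∷ []) (r ∷ _) l = r ∷ l
    Linked-join (x ∷ y ∷ xs) (r ∷ l₁) l = r ∷ Linked-join (y ∷ xs) l₁ l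

    Linked-middle : ∀ (xs : List A) {a b ys} → Linked R (xs ++ a ∷ b ∷ ys) → R a b
    Linked-middle xs l = Lk.head (Linked-++⁻ʳ xs l)

    Linked-∷ʳ : ∀ (xs : List A) {a b} → Linked R (xs ++ [ a ]) → R a b → Linked R (xs ++ a ∷ [ b ])
    Linked-∷ʳ xs l r = Linked-join xs l (r ∷ [-])

    Linked-reverse⁺ : Symmetric R → ∀ {xs} → Linked R xs → Linked R (reverse xs)
    Linked-reverse⁺ s [] = []
    Linked-reverse⁺ s [-] = [-]
    Linked-reverse⁺ s {x ∷ y ∷ xs} (r ∷ l) =
      subst (Linked R) (sym reverse-x∷y∷xs)
        (Linked-∷ʳ (reverse xs) (subst (Linked R) (unfold-reverse y xs) (Linked-reverse⁺ s l)) (s r))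
      where
      reverse-x∷y∷xs : reverse (x ∷ y ∷ xs) ≡ reverse xs ++ y ∷ [ x ]
      reverse-x∷y∷xs = begin
        reverse (x ∷ y ∷ xs)           ≡⟨ unfold-reverse x (y ∷ xs) ⟩
        reverse (y ∷ xs) ++ [ x ]      ≡⟨ cong (_++ [ x ]) (unfold-reverse y xs) ⟩
        (reverse xs ++ [ y ]) ++ [ x ] ≡⟨ ++-assoc (reverse xs) [ y ] [ x ] ⟩
        reverse xs ++ y ∷ [ x ]        ∎
        where open ≡-Reasoning

  module _ {P : A → Set} where

    length-─ : ∀ {xs} (p : Any P xs) → length xs ≡ suc (length (xs Any.─ p))
    length-─ (here _) = refl
    length-─ (there p) = cong suc (length-─ p)

    All-─ : ∀ {Q : A → Set} {xs} (p : Any P xs) → All Q xs → Q (Any.lookup p) × All Q (xs Any.─ p)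
    All-─ p qs = proj₁ (All.lookupAny qs p) , AllP.─⁺ p qs

    AllPairs-─ : ∀ {R : A → A → Set} {xs} → Symmetric R → (p : Any P xs) → AllPairs R xs →
                 All (R (Any.lookup p)) (xs Any.─ p) × AllPairs R (xs Any.─ p)
    AllPairs-─ s (here _) (rx ∷ rs) = rx , rs
    AllPairs-─ s (there p) (rx ∷ rs) =
      (s (proj₁ (All-─ p rx)) ∷ proj₁ (AllPairs-─ s p rs)) , (proj₂ (All-─ p rx) ∷ proj₂ (AllPairs-─ s p rs))

    Any-─ : ∀ {Q : A → Set} {xs} (p : Any P xs) → Any Q xs → Q (Any.lookup p) ⊎ Any Q (xs Any.─ p)
    Any-─ (here _) (here q) = inj₁ q
    Any-─ (here _) (there q) = inj₂ q
    Any-─ (there p) (here q) = inj₂ (here q)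
    Any-─ (there p) (there q) = Data.Sum.map₂ there (Any-─ p q)

Unique-concatMap⁺ : {A B : Set} (f : A → List B) (g : B → A) {xs : List A} → Unique xs →
  (∀ x → Unique (f x)) → (∀ x {y} → y ∈ f x → g y ≡ x) → Unique (concatMap f xs)
Unique-concatMap⁺ f g {[]} _ _ _ = []
Unique-concatMap⁺ f g {x ∷ xs} u uf gf = UP.++⁺ (uf x) (Unique-concatMap⁺ f g (Unique-tail u) uf gf) disjoint
  where
  disjoint : Disjoint (f x) (concatMap f xs)
  disjoint (y∈fx , y∈rest) with find (∈-concatMap⁻ f {xs = xs} y∈rest)
  ... | x' , x'∈ , y∈fx' = Unique[x∷xs]⇒x∉xs u (subst (_∈ xs) (trans (sym (gf x' y∈fx')) (gf x y∈fx)) x'∈)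

Unique-lookup-injective : {A : Set} {xs : List A} → Unique xs → ∀ i j → lookup xs i ≡ lookup xs j → i ≡ j
Unique-lookup-injective {xs = x ∷ xs} u Fin.zero Fin.zero eq = refl
Unique-lookup-injective {xs = x ∷ xs} u Fin.zero (Fin.suc j) eq = ⊥-elim (Unique[x∷xs]⇒x∉xs u (subst (_∈ xs) (sym eq) (∈-lookup j)))
Unique-lookup-injective {xs = x ∷ xs} u (Fin.suc i) Fin.zero eq = ⊥-elim (Unique[x∷xs]⇒x∉xs u (subst (_∈ xs) eq (∈-lookup i)))
Unique-lookup-injective {xs = x ∷ xs} u (Fin.suc i) (Fin.suc j) eq = cong Fin.suc (Unique-lookup-injective (Unique-tail u) i j eq)

lastSatisfying : ∀ {A : Set} {P : A → Set} → (∀ x → Dec (P x)) → ∀ {xs} → Any P xs →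
  Σ (List A) (λ ys → Σ A (λ x → Σ (List A) (λ zs → xs ≡ ys ++ x ∷ zs × P x × All (¬_ ∘ P) zs)))
lastSatisfying P? {z ∷ zs} p with Any.any? P? zs
... | yes p′ with lastSatisfying P? p′
...   | ys , x , ws , eq , px , ws∉ = z ∷ ys , x , ws , cong (z ∷_) eq , px , ws∉
lastSatisfying P? {z ∷ zs} (here pz) | no ¬any = [] , z , zs , refl , pz , AllP.¬Any⇒All¬ zs ¬any
lastSatisfying P? {z ∷ zs} (there p′) | no ¬any = ⊥-elim (¬any p′)

AllTriples : {A : Set} (R : A → A → A → Set) → List A → Set
AllTriples R [] = ⊤
AllTriples R (x ∷ xs) = AllPairs (R x) xs × AllTriples R xs

AllTriples-map⁺ : {A B : Set} {R : B → B → B → Set} (f : A → B) (xs : List A) →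
                  AllTriples (λ a b c → R (f a) (f b) (f c)) xs → AllTriples R (map f xs)
AllTriples-map⁺ f [] _ = tt
AllTriples-map⁺ f (x ∷ xs) (rs , t) = APP.map⁺ rs , AllTriples-map⁺ f xs t

AllPairs-withAll : ∀ {A : Set} {P : A → Set} {R : A → A → Set} {xs} → All P xs → AllPairs R xs →
                   AllPairs (λ x y → P x × P y × R x y) xs
AllPairs-withAll [] [] = []
AllPairs-withAll (px ∷ pxs) (rx ∷ rs) = All.map (λ (py , r) → px , py , r) (All.zip (pxs , rx)) ∷ AllPairs-withAll pxs rs

AllTriples-fromPairs : ∀ {A : Set} {P : A → Set} {R : A → A → Set} {T : A → A → A → Set} →
  (∀ {x y z} → P x → P y → P z → R x y → R x z → R y z → T x y z) →
  ∀ {xs} → All P xs → AllPairs R xs → AllTriples T xs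
AllTriples-fromPairs t [] [] = tt
AllTriples-fromPairs {P = P} {R} {T} t {x ∷ xs} (px ∷ pxs) (rx ∷ rs) = withFirst pxs rx rs , AllTriples-fromPairs t pxs rs
  where
  withFirst : ∀ {ys} → All P ys → All (R x) ys → AllPairs R ys → AllPairs (T x) ys
  withFirst [] [] [] = []
  withFirst (py ∷ pys) (rxy ∷ rxs) (ry ∷ rys) =
    All.map (λ (pz , rxz , ryz) → t px py pz rxy rxz ryz) (All.zip (pys , All.zip (rxs , ry))) ∷ withFirst pys rxs rys

Unique-length≤ : ∀ {k} {xs : List (Fin k)} → Unique xs → length xs ≤ k
Unique-length≤ {k} u = ≤-trans (Unique-⊆⇒length≤ u (λ {v} _ → ∈-allFin v)) (≤-reflexive (length-tabulate {n = k} (λ x → x)))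

∃-ofLength? : ∀ {k} (j : ℕ) (P : List (Fin k) → Set) → (∀ xs → Dec (P xs)) →
              Dec (Σ (List (Fin k)) (λ xs → length xs ≡ j × P xs))
∃-ofLength? zero P P? with P? []
... | yes p = yes ([] , refl , p)
... | no ¬p = no λ { ([] , refl , p) → ¬p p }
∃-ofLength? (suc j) P P? with FP.any? (λ x → ∃-ofLength? j (λ ys → P (x ∷ ys)) (λ ys → P? (x ∷ ys)))
... | yes (x , ys , eq , p) = yes (x ∷ ys , cong suc eq , p)
... | no ¬q = no λ { ([] , () , _) ; (x ∷ ys , eq , p) → ¬q (x , ys , suc-injective eq , p) }

∃-ofLength≤? : ∀ {k} (j : ℕ) (P : List (Fin k) → Set) → (∀ xs → Dec (P xs)) →
               Dec (Σ (List (Fin k)) (λ xs → length xs ≤ j × P xs))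
∃-ofLength≤? zero P P? with ∃-ofLength? 0 P P?
... | yes (xs , eq , p) = yes (xs , ≤-reflexive eq , p)
... | no ¬q = no λ { (xs , le , p) → ¬q (xs , n≤0⇒n≡0 le , p) }
∃-ofLength≤? (suc j) P P? with ∃-ofLength? (suc j) P P? | ∃-ofLength≤? j P P?
... | yes (xs , eq , p) | _ = yes (xs , ≤-reflexive eq , p)
... | no _ | yes (xs , le , p) = yes (xs , m≤n⇒m≤1+n le , p)
... | no ¬a | no ¬b = no λ { (xs , le , p) →
  [ (λ lt → ¬b (xs , ≤-pred lt , p)) , (λ eq → ¬a (xs , eq , p)) ]′ (m≤n⇒m<n∨m≡n le) }

module _ {k : ℕ} where

  _∈?_ : ∀ (i : Fin k) xs → Dec (i ∈ xs)
  i ∈? xs = Any.any? (i ≟F_) xs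

  complement : List (Fin k) → List (Fin k)
  complement xs = filter (λ i → ¬? (i ∈? xs)) (allFin k)

  complement-unique : ∀ xs → Unique (complement xs)
  complement-unique xs = UP.filter⁺ (λ i → ¬? (i ∈? xs)) (UP.allFin⁺ k)

  ∈-complement⁺ : ∀ {i xs} → i ∉ xs → i ∈ complement xs
  ∈-complement⁺ {i} {xs} i∉ = ∈-filter⁺ (λ i → ¬? (i ∈? xs)) (∈-allFin i) i∉

  ∈-complement⁻ : ∀ {i xs} → i ∈ complement xs → i ∉ xs
  ∈-complement⁻ {xs = xs} i∈ = proj₂ (∈-filter⁻ (λ i → ¬? (i ∈? xs)) {xs = allFin k} i∈)

  length-complement : ∀ {xs} → Unique xs → length xs + length (complement xs) ≡ k
  length-complement {xs} u = begin
    length xs + length (complement xs)          ≡⟨ cong (_+ length (complement xs)) |xs|≡|inside| ⟩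
    length inside + length (complement xs)      ≡⟨ length-filter+filter¬ (_∈? xs) (allFin k) ⟩
    length (allFin k)                           ≡⟨ length-tabulate (λ i → i) ⟩
    k                                           ∎
    where
    open ≡-Reasoning
    inside = filter (_∈? xs) (allFin k)
    |xs|≡|inside| : length xs ≡ length inside
    |xs|≡|inside| = ≤-antisym
      (Unique-⊆⇒length≤ u (λ {i} i∈ → ∈-filter⁺ (_∈? xs) (∈-allFin i) i∈))
      (Unique-⊆⇒length≤ (UP.filter⁺ (_∈? xs) (UP.allFin⁺ k)) (λ i∈ → proj₂ (∈-filter⁻ (_∈? xs) {xs = allFin k} i∈)))

minimal : ∀ {P : ℕ → Set} → (∀ k → Dec (P k)) → ∀ {n} → P n → Σ ℕ (λ k → P k × (∀ j → j < k → ¬ P j))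
minimal {P} P? {n} = from n 0 (λ _ ())
  where
  from : ∀ fuel s → (∀ j → j < s → ¬ P j) → P (s + fuel) → Σ ℕ (λ k → P k × (∀ j → j < k → ¬ P j))
  from fuel s below p with P? s
  ... | yes ps = s , ps , below
  from zero s below p | no ¬ps = ⊥-elim (¬ps (subst P (+-identityʳ s) p))
  from (suc fuel) s below p | no ¬ps = from fuel (suc s) below′ (subst P (+-suc s fuel) p)
    where
    below′ : ∀ j → j < suc s → ¬ P j
    below′ j j<1+s with m≤n⇒m<n∨m≡n (≤-pred j<1+s)
    ... | inj₁ j<s = below j j<s
    ... | inj₂ refl = ¬ps

sum≤*length : ∀ c (ls : List ℕ) → All (_≤ c) ls → sum ls ≤ c * length ls
sum≤*length c [] [] = z≤n
sum≤*length c (l ∷ ls) (l≤c ∷ ls≤c) =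
  subst (l + sum ls ≤_) (sym (*-suc c (length ls))) (+-mono-≤ l≤c (sum≤*length c ls ls≤c))

sum≤*length+-atMostOneAbove : ∀ c e (ls : List ℕ) → AllPairs (λ a b → ¬ (c < a × c < b)) ls →
  All (λ a → c < a → a ≤ c + e) ls → sum ls ≤ c * length ls + e
sum≤*length+-atMostOneAbove c e [] _ _ = z≤n
sum≤*length+-atMostOneAbove c e (l ∷ ls) (notBoth ∷ rs) (bound ∷ bounds) with c <? l
... | yes c<l = ≤-trans (+-mono-≤ (bound c<l) (sum≤*length c ls (All.map (λ nb → ≮⇒≥ (λ c<l′ → nb (c<l , c<l′))) notBoth)))
                        (≤-reflexive (rearrange c e (length ls)))
  where
  rearrange : ∀ c e k → c + e + c * k ≡ c * suc k + e
  rearrange = solve-∀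
... | no c≮l = ≤-trans (+-mono-≤ (≮⇒≥ c≮l) (sum≤*length+-atMostOneAbove c e ls rs bounds))
                       (≤-reflexive (rearrange c e (length ls)))
  where
  rearrange : ∀ c e k → c + (c * k + e) ≡ c * suc k + e
  rearrange = solve-∀

sum≤*length+4-atMostTwoAbove : ∀ c (ls : List ℕ) →
  AllPairs (λ a b → c < a → c < b → a ≤ c + 2 × b ≤ c + 2) ls →
  AllTriples (λ a b d → c < a → c < b → c < d → ⊥) ls → All (_≤ c + 3) ls → sum ls ≤ c * length ls + 4
sum≤*length+4-atMostTwoAbove c [] _ _ _ = z≤n
sum≤*length+4-atMostTwoAbove c (l ∷ ls) (pair ∷ pairs) (triple , triples) (bound ∷ bounds) with c <? l
... | no c≮l = ≤-trans (+-mono-≤ (≮⇒≥ c≮l) (sum≤*length+4-atMostTwoAbove c ls pairs triples bounds))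
                       (≤-reflexive (rearrange c (length ls)))
  where
  rearrange : ∀ c k → c + (c * k + 4) ≡ c * suc k + 4
  rearrange = solve-∀
... | yes c<l with Any.any? (c <?_) ls
...   | no none = ≤-trans (+-mono-≤ (≤-trans bound (+-monoʳ-≤ c (n≤1+n 3)))
                                     (sum≤*length c ls (All.map ≮⇒≥ (AllP.¬Any⇒All¬ ls none))))
                          (≤-reflexive (rearrange c (length ls)))
  where
  rearrange : ∀ c k → c + 4 + c * k ≡ c * suc k + 4
  rearrange = solve-∀
...   | yes some with find some
...     | l′ , l′∈ , c<l′ =
  ≤-trans (+-mono-≤ (proj₁ (All.lookup pair l′∈ c<l c<l′))
                    (sum≤*length+-atMostOneAbove c 2 ls (AP.map (λ t (c<a , c<b) → t c<l c<a c<b) triple)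
                                                        (All.map (λ pr c<a → proj₂ (pr c<l c<a)) pair)))
          (≤-reflexive (rearrange c (length ls)))
  where
  rearrange : ∀ c k → c + 2 + (c * k + 2) ≡ c * suc k + 4
  rearrange = solve-∀

r<half : ∀ r h L → r + r ≤ L → suc L ≤ h + h → r < h
r<half r h L 2r≤L 1+L≤2h with suc r ≤? h
... | yes r<h = r<h
... | no r≮h = ⊥-elim (<-irrefl refl (≤-trans 1+L≤2h (≤-trans (+-mono-≤ h≤r h≤r) 2r≤L)))
  where
  h≤r : h ≤ r
  h≤r = ≤-pred (≰⇒> r≮h)

1+r+1+r≡2+r+r : ∀ r → suc r + suc r ≡ suc (suc (r + r))
1+r+1+r≡2+r+r r = cong suc (+-suc r r)

even-longPair-absurd : ∀ r hX hY t LX LY → suc LX ≤ hX + hX → suc LY ≤ hY + hY → hX + t + hY ≤ suc (r + r) →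
                       r + r ≤ LX → r + r ≤ LY → ⊥
even-longPair-absurd r hX hY t LX LY bX bY b 2r≤LX 2r≤LY =
  <-irrefl refl (≤-pred (≤-trans (≤-reflexive (sym (1+r+1+r≡2+r+r r)))
    (≤-trans (+-mono-≤ (r<half r hX LX 2r≤LX bX) (r<half r hY LY 2r≤LY bY))
             (≤-trans (+-monoˡ-≤ hY (m≤m+n hX t)) b))))

odd-longPair-bound : ∀ r hX hY t LX LY → suc LX ≤ hX + hX → suc LY ≤ hY + hY → hX + t + hY ≤ suc (suc (r + r)) →
                     r + r ≤ LX → r + r ≤ LY → LX ≤ suc (r + r)
odd-longPair-bound r hX hY t LX LY bX bY b 2r≤LX 2r≤LY =
  ≤-pred (≤-trans bX (≤-trans (+-mono-≤ hX≤1+r hX≤1+r) (≤-reflexive (1+r+1+r≡2+r+r r))))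
  where
  hX+1+r≤ : hX + suc r ≤ suc r + suc r
  hX+1+r≤ = ≤-trans (+-monoʳ-≤ hX (r<half r hY LY 2r≤LY bY))
              (≤-trans (≤-trans (+-monoˡ-≤ hY (m≤m+n hX t)) b) (≤-reflexive (sym (1+r+1+r≡2+r+r r))))
  hX≤1+r : hX ≤ suc r
  hX≤1+r = +-cancelˡ-≤ (suc r) hX (suc r) (subst (_≤ suc r + suc r) (+-comm hX (suc r)) hX+1+r≤)

odd-longPairWithInterior-absurd : ∀ r hX hY LX LY → suc LX ≤ hX + hX → suc LY ≤ hY + hY →
  hX + 1 + hY ≤ suc (suc (r + r)) → r + r ≤ LX → r + r ≤ LY → ⊥
odd-longPairWithInterior-absurd r hX hY LX LY bX bY b 2r≤LX 2r≤LY =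
  <-irrefl refl (≤-pred (≤-trans (≤-reflexive (cong suc (sym (1+r+1+r≡2+r+r r))))
    (≤-trans (s≤s (+-mono-≤ (r<half r hX LX 2r≤LX bX) (r<half r hY LY 2r≤LY bY)))
      (≤-trans (≤-reflexive (sym (trans (+-assoc hX 1 hY) (+-suc hX hY)))) b))))

lowerBound-arithmetic : ∀ c e {n m k f s} → k + f ≡ n → n ≤ suc c * k + e → m ≤ s + f →
                        m ∸ (c * n + e) / suc c ≤ s
lowerBound-arithmetic c e {n} {m} {k} {f} {s} k+f≡n n≤ m≤s+f =
  m≤n+o⇒m∸n≤o m _ (≤-trans m≤s+f (≤-trans (+-monoʳ-≤ s f≤quotient) (≤-reflexive (+-comm s _))))
  where
  f≤c*k+e : f ≤ c * k + e
  f≤c*k+e = +-cancelˡ-≤ k f (c * k + e)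
    (subst (k + f ≤_) (+-assoc k (c * k) e) (subst (_≤ suc c * k + e) (sym k+f≡n) n≤))
  f*[1+c]≤ : f * suc c ≤ c * n + e
  f*[1+c]≤ = begin
    f * suc c         ≡⟨ *-suc f c ⟩
    f + f * c         ≤⟨ +-monoˡ-≤ (f * c) f≤c*k+e ⟩
    c * k + e + f * c ≡⟨ rearrange c k f e ⟩
    c * (k + f) + e   ≡⟨ cong (λ t → c * t + e) k+f≡n ⟩
    c * n + e         ∎
    where
    open ≤-Reasoning
    rearrange : ∀ c k f e → c * k + e + f * c ≡ c * (k + f) + e
    rearrange = solve-∀
  f≤quotient : f ≤ (c * n + e) / suc c
  f≤quotient = subst (_≤ (c * n + e) / suc c) (m*n/n≡m f (suc c)) (/-monoˡ-≤ (suc c) f*[1+c]≤)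

2∣⇒even : ∀ {p} → 2 ∣ p → Σ ℕ (λ r → p ≡ r + r)
2∣⇒even (divides r p≡r*2) = r , trans p≡r*2 (r*2≡r+r r)
  where
  r*2≡r+r : ∀ r → r * 2 ≡ r + r
  r*2≡r+r = solve-∀

¬2∣⇒odd : ∀ p → ¬ (2 ∣ p) → Σ ℕ (λ r → p ≡ suc (r + r))
¬2∣⇒odd zero ¬2∣ = ⊥-elim (¬2∣ (divides 0 refl))
¬2∣⇒odd (suc zero) _ = 0 , refl
¬2∣⇒odd (suc (suc p)) ¬2∣ with ¬2∣⇒odd p (λ { (divides q eq) → ¬2∣ (divides (suc q) (cong (2 +_) eq)) })
... | r , p≡1+r+r = suc r , cong suc (trans (cong suc p≡1+r+r) (cong suc (sym (+-suc r r))))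

module DecyclingNumberOf {k : ℕ} (_≈_ : Fin k → Fin k → Set) (_≈?_ : ∀ i j → Dec (i ≈ j)) where

  H : Graph
  H = record { V = Fin k ; Adj = _≈_ }

  isCycle? : ∀ xs → Dec (IsCycle H xs)
  isCycle? xs = (3 ≤? length xs) ×-dec (AP.allPairs? (λ i j → ¬? (i ≟F j)) xs ×-dec Lk.linked? _≈?_ (xs ++ take 1 xs))

  cycleAvoiding? : ∀ S → Dec (Σ (List (Fin k)) (λ xs → IsCycle H xs × All (_∉ S) xs))
  cycleAvoiding? S with ∃-ofLength≤? k (λ xs → IsCycle H xs × All (_∉ S) xs)
                          (λ xs → isCycle? xs ×-dec All.all? (λ i → ¬? (i ∈? S)) xs)
  ... | yes (xs , _ , c) = yes (xs , c)
  ... | no ¬c = no λ { (xs , c) → ¬c (xs , Unique-length≤ (proj₁ (proj₂ (proj₁ c))) , c) }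

  isDecyclingSet? : ∀ S → Dec (IsDecyclingSet H S)
  isDecyclingSet? S = AP.allPairs? (λ i j → ¬? (i ≟F j)) S ×-dec ¬? (cycleAvoiding? S)

  DecyclingSetOfSize : ℕ → Set
  DecyclingSetOfSize d = Σ (List (Fin k)) (λ S → IsDecyclingSet H S × length S ≡ d)

  decyclingSetOfSize? : ∀ d → Dec (DecyclingSetOfSize d)
  decyclingSetOfSize? d with ∃-ofLength? d (IsDecyclingSet H) isDecyclingSet?
  ... | yes (S , eq , ds) = yes (S , ds , eq)
  ... | no ¬ds = no λ { (S , ds , eq) → ¬ds (S , eq , ds) }

  decyclingNumber : ∀ S₀ → IsDecyclingSet H S₀ → Σ ℕ (λ d → IsDecyclingNumber H d × d ≤ length S₀)
  decyclingNumber S₀ ds₀ with minimal decyclingSetOfSize? (S₀ , ds₀ , refl)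
  ... | d , ofSize-d , belowNone =
    d , (ofSize-d , λ S ds → ≮⇒≥ (λ lt → belowNone _ lt (S , ds , refl))) ,
    ≮⇒≥ (λ lt → belowNone _ lt (S₀ , ds₀ , refl))

module LineGraphOf {n : ℕ} (G : SimpleGraph n) where

  V : Set
  V = Fin n

  _∼_ : V → V → Set
  u ∼ v = adj G u v ≡ true

  ∼-sym : ∀ {u v} → u ∼ v → v ∼ u
  ∼-sym {u} {v} e = trans (adj-sym G v u) e

  ∼-irrefl : ∀ {u} → u ∼ u → ⊥
  ∼-irrefl {u} e with trans (sym (irrefl G u)) e
  ... | ()

  E : List (V × V)
  E = edges G

  m : ℕ
  m = numEdges G

  end₁ end₂ : Fin m → V
  end₁ k = proj₁ (lookup E k)
  end₂ k = proj₂ (lookup E k)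

  Incident : Fin m → V → Set
  Incident k x = end₁ k ≡ x ⊎ end₂ k ≡ x

  Joins : Fin m → V → V → Set
  Joins k a b = (end₁ k ≡ a × end₂ k ≡ b) ⊎ (end₁ k ≡ b × end₂ k ≡ a)

  L : Graph
  L = LineGraph G

  _∼ᴸ_ : Fin m → Fin m → Set
  _∼ᴸ_ = Adj L

  -- E is definitionally concatMap edgeRow (allFin n).
  edgeEntry : V → V → List (V × V)
  edgeEntry i j = if (toℕ i <ᵇ toℕ j) ∧ adj G i j then [ (i , j) ] else []

  ∈-edgeEntry⁻ : ∀ i j {y} → y ∈ edgeEntry i j → y ≡ (i , j) × i ∼ j × toℕ i < toℕ j
  ∈-edgeEntry⁻ i j y∈ with toℕ i <ᵇ toℕ j in i<ᵇj | adj G i j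
  ∈-edgeEntry⁻ i j (here refl) | true | true = refl , refl , <ᵇ⇒< (toℕ i) (toℕ j) (subst T (sym i<ᵇj) tt)

  ∈-edgeEntry⁺ : ∀ i j → i ∼ j → toℕ i < toℕ j → (i , j) ∈ edgeEntry i j
  ∈-edgeEntry⁺ i j i∼j i<j with toℕ i <ᵇ toℕ j in i<ᵇj | adj G i j
  ... | true | true = here refl
  ... | false | _ = ⊥-elim (subst T i<ᵇj (<⇒<ᵇ i<j))
  ∈-edgeEntry⁺ i j () i<j | true | false

  edgeEntry-unique : ∀ i j → Unique (edgeEntry i j)
  edgeEntry-unique i j with (toℕ i <ᵇ toℕ j) ∧ adj G i j
  ... | true = [] ∷ []
  ... | false = []

  edgeRow : V → List (V × V)
  edgeRow i = concatMap (edgeEntry i) (allFin n)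

  ∈-edgeRow⁻ : ∀ i {y} → y ∈ edgeRow i → proj₁ y ≡ i × proj₁ y ∼ proj₂ y × toℕ (proj₁ y) < toℕ (proj₂ y)
  ∈-edgeRow⁻ i y∈ with find (∈-concatMap⁻ (edgeEntry i) {xs = allFin n} y∈)
  ... | j , _ , y∈entry with ∈-edgeEntry⁻ i j y∈entry
  ... | refl , i∼j , i<j = refl , i∼j , i<j

  E-unique : Unique E
  E-unique = Unique-concatMap⁺ edgeRow proj₁ (UP.allFin⁺ n)
    (λ i → Unique-concatMap⁺ (edgeEntry i) proj₂ (UP.allFin⁺ n) (edgeEntry-unique i)
             (λ j y∈ → cong proj₂ (proj₁ (∈-edgeEntry⁻ i j y∈))))
    (λ i y∈ → proj₁ (∈-edgeRow⁻ i y∈))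

  ∈-E⁻ : ∀ {y} → y ∈ E → proj₁ y ∼ proj₂ y × toℕ (proj₁ y) < toℕ (proj₂ y)
  ∈-E⁻ y∈ with find (∈-concatMap⁻ edgeRow {xs = allFin n} y∈)
  ... | i , _ , y∈row = proj₂ (∈-edgeRow⁻ i y∈row)

  ∈-E⁺ : ∀ {a b} → a ∼ b → toℕ a < toℕ b → (a , b) ∈ E
  ∈-E⁺ {a} {b} a∼b a<b =
    ∈-concatMap⁺ edgeRow {xs = allFin n} (lose (∈-allFin a)
      (∈-concatMap⁺ (edgeEntry a) {xs = allFin n} (lose (∈-allFin b) (∈-edgeEntry⁺ a b a∼b a<b))))

  edge-∼ : ∀ k → end₁ k ∼ end₂ k
  edge-∼ k = proj₁ (∈-E⁻ (∈-lookup k))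

  edge-< : ∀ k → toℕ (end₁ k) < toℕ (end₂ k)
  edge-< k = proj₂ (∈-E⁻ (∈-lookup k))

  Joins⇒∼ : ∀ {k a b} → Joins k a b → a ∼ b
  Joins⇒∼ {k} (inj₁ (refl , refl)) = edge-∼ k
  Joins⇒∼ {k} (inj₂ (refl , refl)) = ∼-sym (edge-∼ k)

  Joins⇒Incident₁ : ∀ {k a b} → Joins k a b → Incident k a
  Joins⇒Incident₁ (inj₁ (p , _)) = inj₁ p
  Joins⇒Incident₁ (inj₂ (_ , q)) = inj₂ q

  Joins⇒Incident₂ : ∀ {k a b} → Joins k a b → Incident k b
  Joins⇒Incident₂ (inj₁ (_ , q)) = inj₂ q
  Joins⇒Incident₂ (inj₂ (p , _)) = inj₁ p

  Incident-Joins : ∀ {k a b x} → Joins k a b → Incident k x → x ≡ a ⊎ x ≡ b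
  Incident-Joins (inj₁ (p , q)) (inj₁ r) = inj₁ (trans (sym r) p)
  Incident-Joins (inj₁ (p , q)) (inj₂ r) = inj₂ (trans (sym r) q)
  Incident-Joins (inj₂ (p , q)) (inj₁ r) = inj₂ (trans (sym r) p)
  Incident-Joins (inj₂ (p , q)) (inj₂ r) = inj₁ (trans (sym r) q)

  Joins-sym : ∀ {k a b} → Joins k a b → Joins k b a
  Joins-sym (inj₁ x) = inj₂ x
  Joins-sym (inj₂ x) = inj₁ x

  Joins-index : ∀ {a b} (ab∈ : (a , b) ∈ E) → Joins (Any.index ab∈) a b
  Joins-index ab∈ = inj₁ (cong proj₁ lookup≡ , cong proj₂ lookup≡)
    where
    lookup≡ = sym (AnyP.lookup-index ab∈)

  edgeIndex : ∀ {a b} → a ∼ b → Σ (Fin m) (λ k → Joins k a b)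
  edgeIndex {a} {b} a∼b with <-cmp (toℕ a) (toℕ b)
  ... | tri< a<b _ _ = _ , Joins-index (∈-E⁺ a∼b a<b)
  ... | tri≈ _ a≡b _ = ⊥-elim (∼-irrefl (subst (a ∼_) (sym (FP.toℕ-injective a≡b)) a∼b))
  ... | tri> _ _ b<a = _ , Joins-sym (Joins-index (∈-E⁺ (∼-sym a∼b) b<a))

  Joins-injective : ∀ {k l a b} → Joins k a b → Joins l a b → k ≡ l
  Joins-injective (inj₁ (p , q)) (inj₁ (r , s)) =
    Unique-lookup-injective E-unique _ _ (cong₂ _,_ (trans p (sym r)) (trans q (sym s)))
  Joins-injective (inj₂ (p , q)) (inj₂ (r , s)) =
    Unique-lookup-injective E-unique _ _ (cong₂ _,_ (trans p (sym r)) (trans q (sym s)))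
  Joins-injective {k} {l} (inj₁ (refl , refl)) (inj₂ (r , s)) =
    ⊥-elim (<-asym (edge-< k) (subst₂ (λ x y → toℕ x < toℕ y) r s (edge-< l)))
  Joins-injective {k} {l} (inj₂ (refl , refl)) (inj₁ (r , s)) =
    ⊥-elim (<-asym (edge-< k) (subst₂ (λ x y → toℕ x < toℕ y) r s (edge-< l)))

  Incident⇒Share : ∀ {k l x} → Incident k x → Incident l x → ShareEndpoint (lookup E k) (lookup E l)
  Incident⇒Share (inj₁ p) (inj₁ q) = inj₁ (inj₁ (trans p (sym q)))
  Incident⇒Share (inj₁ p) (inj₂ q) = inj₁ (inj₂ (trans p (sym q)))
  Incident⇒Share (inj₂ p) (inj₁ q) = inj₂ (inj₁ (trans p (sym q)))
  Incident⇒Share (inj₂ p) (inj₂ q) = inj₂ (inj₂ (trans p (sym q)))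

  Share⇒Incident : ∀ {k l} → ShareEndpoint (lookup E k) (lookup E l) → Σ V (λ x → Incident k x × Incident l x)
  Share⇒Incident (inj₁ (inj₁ p)) = _ , inj₁ refl , inj₁ (sym p)
  Share⇒Incident (inj₁ (inj₂ p)) = _ , inj₁ refl , inj₂ (sym p)
  Share⇒Incident (inj₂ (inj₁ p)) = _ , inj₂ refl , inj₁ (sym p)
  Share⇒Incident (inj₂ (inj₂ p)) = _ , inj₂ refl , inj₂ (sym p)

  ∼ᴸ-intro : ∀ {k l x} → k ≢ l → Incident k x → Incident l x → k ∼ᴸ l
  ∼ᴸ-intro k≢l k∋x l∋x = k≢l , Incident⇒Share k∋x l∋x

  ∼ᴸ-sym : ∀ {k l} → k ∼ᴸ l → l ∼ᴸ k
  ∼ᴸ-sym (k≢l , share) with Share⇒Incident share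
  ... | x , k∋x , l∋x = (λ l≡k → k≢l (sym l≡k)) , Incident⇒Share l∋x k∋x

  _∼ᴸ?_ : ∀ k l → Dec (k ∼ᴸ l)
  k ∼ᴸ? l = ¬? (k ≟F l) ×-dec (((end₁ k ≟F end₁ l) ⊎-dec (end₁ k ≟F end₂ l)) ⊎-dec
                                ((end₂ k ≟F end₁ l) ⊎-dec (end₂ k ≟F end₂ l)))

  open DecyclingNumberOf _∼ᴸ_ _∼ᴸ?_ public using (decyclingNumber)

  EdgeIn : (Fin m → Set) → V → V → Set
  EdgeIn Q a b = Σ (Fin m) (λ k → Q k × Joins k a b)

  EdgeIn-sym : ∀ {Q a b} → EdgeIn Q a b → EdgeIn Q b a
  EdgeIn-sym (k , q , e) = k , q , Joins-sym e

  edgesOf : ∀ {Q xs} → Linked (EdgeIn Q) xs → List (Fin m)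
  edgesOf [] = []
  edgesOf [-] = []
  edgesOf (r ∷ l) = proj₁ r ∷ edgesOf l

  edgesOf-in : ∀ {Q xs} (l : Linked (EdgeIn Q) xs) → All Q (edgesOf l)
  edgesOf-in [] = []
  edgesOf-in [-] = []
  edgesOf-in (r ∷ l) = proj₁ (proj₂ r) ∷ edgesOf-in l

  edgesOf-incident : ∀ {Q xs} (l : Linked (EdgeIn Q) xs) → All (λ k → ∀ {w} → Incident k w → w ∈ xs) (edgesOf l)
  edgesOf-incident [] = []
  edgesOf-incident [-] = []
  edgesOf-incident (r ∷ l) =
    (λ {w} k∋w → [ here , (λ w≡ → there (here w≡)) ]′ (Incident-Joins (proj₂ (proj₂ r)) k∋w))
    ∷ All.map (λ incident {w} k∋w → there (incident k∋w)) (edgesOf-incident l)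

  edgesOf-unique : ∀ {Q xs} → Unique xs → (l : Linked (EdgeIn Q) xs) → Unique (edgesOf l)
  edgesOf-unique u [] = []
  edgesOf-unique u [-] = []
  edgesOf-unique u (r ∷ l) =
    Unique-∷⁺ (λ k∈ → Unique[x∷xs]⇒x∉xs u (All.lookup (edgesOf-incident l) k∈ (Joins⇒Incident₁ (proj₂ (proj₂ r)))))
              (edgesOf-unique (Unique-tail u) l)

  edgesOf-length : ∀ {Q x xs} (l : Linked (EdgeIn Q) (x ∷ xs)) → length (edgesOf l) ≡ length xs
  edgesOf-length [-] = refl
  edgesOf-length (r ∷ l) = cong suc (edgesOf-length l)

  edgesOf-closed : ∀ {Q xs z g} → Unique xs → (l : Linked (EdgeIn Q) xs) → g ∉ edgesOf l → Incident g z →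
                   last xs ≡ just z → 2 ≤ length xs → Linked _∼ᴸ_ (edgesOf l ++ [ g ])
  edgesOf-closed u [] _ _ _ ()
  edgesOf-closed u [-] _ _ _ (s≤s ())
  edgesOf-closed u (r ∷ [-]) g∉ g∋z refl _ =
    ∼ᴸ-intro (λ eq → g∉ (here (sym eq))) (Joins⇒Incident₂ (proj₂ (proj₂ r))) g∋z ∷ [-]
  edgesOf-closed u (r ∷ (r′ ∷ l)) g∉ g∋z last≡z _ =
    ∼ᴸ-intro (λ eq → Unique[x∷xs]⇒x∉xs (edgesOf-unique u (r ∷ r′ ∷ l)) (here eq))
             (Joins⇒Incident₂ (proj₂ (proj₂ r))) (Joins⇒Incident₁ (proj₂ (proj₂ r′)))
    ∷ edgesOf-closed (Unique-tail u) (r′ ∷ l) (λ g∈ → g∉ (there g∈)) g∋z last≡z (s≤s (s≤s z≤n))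

  Closed : List (Fin m) → Set
  Closed cs = Linked _∼ᴸ_ (cs ++ take 1 cs)

  Closed-rotate₁ : ∀ x ws → Closed (x ∷ ws) → Closed (ws ++ [ x ])
  Closed-rotate₁ x [] c = c
  Closed-rotate₁ x (y ∷ zs) (r ∷ l) = subst (Linked _∼ᴸ_) (sym (++-assoc (y ∷ zs) [ x ] [ y ])) (Linked-∷ʳ (y ∷ zs) l r)

  Closed-rotate : ∀ A {k B} → Closed (A ++ k ∷ B) → Closed (k ∷ B ++ A)
  Closed-rotate [] {k} {B} c = subst (λ w → Closed (k ∷ w)) (sym (++-identityʳ B)) c
  Closed-rotate (a ∷ A) {k} {B} c =
    subst (λ w → Closed (k ∷ w)) (++-assoc B [ a ] A)
      (Closed-rotate A {k} {B ++ [ a ]} (subst Closed (++-assoc A (k ∷ B) [ a ]) (Closed-rotate₁ a (A ++ k ∷ B) c)))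

  IsCycle-rotate : ∀ A {k B} → IsCycle L (A ++ k ∷ B) → IsCycle L (k ∷ B ++ A)
  IsCycle-rotate A {k} {B} (len , u , c) =
    subst (3 ≤_) (length-++-comm A (k ∷ B)) len , Unique-++-comm A u , Closed-rotate A c

  cycle-neighbours : ∀ {k W} → IsCycle L (k ∷ W) →
    Σ (Fin m) (λ b₁ → Σ (List (Fin m)) (λ C → Σ (Fin m) (λ bₗ →
      W ≡ b₁ ∷ C ++ [ bₗ ] × k ∼ᴸ b₁ × k ∼ᴸ bₗ × b₁ ≢ bₗ)))
  cycle-neighbours {k} {[]} (s≤s () , _ , _)
  cycle-neighbours {k} {b₁ ∷ W} (len , u , c) with initLast W
  ... | [] = ⊥-elim (<-irrefl refl (≤-pred len))
  ... | C ∷ʳ′ bₗ =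
    b₁ , C , bₗ , refl , Lk.head c ,
    ∼ᴸ-sym (Linked-middle (k ∷ b₁ ∷ C) (subst (Linked _∼ᴸ_) (cong (λ t → k ∷ b₁ ∷ t) (++-assoc C [ bₗ ] [ k ])) c)) ,
    (λ b₁≡bₗ → Unique[x∷xs]⇒x∉xs (Unique-tail u) (subst (_∈ C ++ [ bₗ ]) (sym b₁≡bₗ) (∈-++⁺ʳ C (here refl))))

module UpperBound {n : ℕ} (G : SimpleGraph n) where
  open LineGraphOf G

  path-edge-neighbour-unique : ∀ {Q x y rest} → Unique (x ∷ y ∷ rest) → (r : EdgeIn Q x y) →
    (l : Linked (EdgeIn Q) (y ∷ rest)) → ∀ {z z′} → z ∈ edgesOf l → z′ ∈ edgesOf l →
    proj₁ r ∼ᴸ z → proj₁ r ∼ᴸ z′ → z ≡ z′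
  path-edge-neighbour-unique u r [-] () _ _ _
  path-edge-neighbour-unique u r (r′ ∷ l) z∈ z′∈ r∼z r∼z′ = trans (isNext z∈ r∼z) (sym (isNext z′∈ r∼z′))
    where
    isNext : ∀ {z} → z ∈ proj₁ r′ ∷ edgesOf l → proj₁ r ∼ᴸ z → z ≡ proj₁ r′
    isNext (here eq) _ = eq
    isNext (there z∈) (_ , share) with Share⇒Incident share
    ... | w , r∋w , z∋w with Incident-Joins (proj₂ (proj₂ r)) r∋w | All.lookup (edgesOf-incident l) z∈ z∋w
    ... | inj₁ refl | w∈ = ⊥-elim (Unique[x∷xs]⇒x∉xs u (there w∈))
    ... | inj₂ refl | w∈ = ⊥-elim (Unique[x∷xs]⇒x∉xs (Unique-tail u) w∈)

  -- On a cycle the first path edge has two neighbours, but it meets only one later path edge.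
  path-edges-acyclic : ∀ {Q xs} → Unique xs → (l : Linked (EdgeIn Q) xs) →
                       ∀ cs → IsCycle L cs → All (_∈ edgesOf l) cs → ⊥
  path-edges-acyclic u [] [] (() , _) _
  path-edges-acyclic u [] (c ∷ _) _ (() ∷ _)
  path-edges-acyclic u [-] [] (() , _) _
  path-edges-acyclic u [-] (c ∷ _) _ (() ∷ _)
  path-edges-acyclic u (r ∷ l) cs cyc cs⊆ with proj₁ r ∈? cs
  ... | no r∉ = path-edges-acyclic (Unique-tail u) l cs cyc (All.tabulate λ c∈ → notFirst c∈ (All.lookup cs⊆ c∈))
    where
    notFirst : ∀ {c} → c ∈ cs → c ∈ proj₁ r ∷ edgesOf l → c ∈ edgesOf l
    notFirst c∈ (here refl) = ⊥-elim (r∉ c∈)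
    notFirst c∈ (there c∈l) = c∈l
  ... | yes r∈ with ∈-∃++ r∈
  ... | A , B , refl with cycle-neighbours (IsCycle-rotate A cyc)
  ... | b₁ , C , bₗ , B++A≡ , r∼b₁ , r∼bₗ , b₁≢bₗ =
    b₁≢bₗ (path-edge-neighbour-unique u r l (inRest (subst (b₁ ∈_) (sym B++A≡) (here refl)))
             (inRest (subst (bₗ ∈_) (sym B++A≡) (there (∈-++⁺ʳ C (here refl))))) r∼b₁ r∼bₗ)
    where
    inRest : ∀ {c} → c ∈ B ++ A → c ∈ edgesOf l
    inRest c∈ with All.lookup cs⊆ ([ (λ h → ∈-++⁺ʳ A (there h)) , ∈-++⁺ˡ ]′ (∈-++⁻ B c∈))
    ... | here refl = ⊥-elim (Unique[x∷xs]⇒x∉xs (proj₁ (proj₂ (IsCycle-rotate A cyc))) c∈)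
    ... | there c∈l = c∈l

  path-edges : ∀ {xs} → Linked _∼_ xs → Linked (EdgeIn (λ _ → ⊤)) xs
  path-edges = Lk.map (λ a∼b → proj₁ (edgeIndex a∼b) , tt , proj₂ (edgeIndex a∼b))

  complementOfPath-decycling : ∀ {p} (xs : List V) → IsPath (toGraph G) xs p →
    Σ (List (Fin m)) (λ S₀ → IsDecyclingSet L S₀ × length S₀ ≡ m ∸ p)
  complementOfPath-decycling [] (() , _)
  complementOfPath-decycling {p} (x ∷ xs) (len , u , linked) =
    complement edgesOnPath , (complement-unique edgesOnPath , acyclic) , length-S₀
    where
    l = path-edges linked
    edgesOnPath = edgesOf l
    acyclic : Acyclic-without L (complement edgesOnPath)
    acyclic (cs , cyc , avoids) =
      path-edges-acyclic u l cs cyc (All.map (λ c∉ → decidable-stable (_ ∈? edgesOnPath) (c∉ ∘ ∈-complement⁺)) avoids)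
    length-S₀ : length (complement edgesOnPath) ≡ m ∸ p
    length-S₀ = begin
      length (complement edgesOnPath)
        ≡⟨ sym (m+n∸m≡n (length edgesOnPath) _) ⟩
      length edgesOnPath + length (complement edgesOnPath) ∸ length edgesOnPath
        ≡⟨ cong₂ _∸_ (length-complement (edgesOf-unique u l)) |edgesOnPath|≡p ⟩
      m ∸ p ∎
      where
      open ≡-Reasoning
      |edgesOnPath|≡p : length edgesOnPath ≡ p
      |edgesOnPath|≡p = trans (edgesOf-length l) (suc-injective len)

module LinearForest {n : ℕ} (G : SimpleGraph n) (InF : Fin (numEdges G) → Set)
                    (acyclic : ∀ cs → IsCycle (LineGraph G) cs → All InF cs → ⊥) where
  open LineGraphOf G

  ForestEdge : List (Fin m) → V → V → Set
  ForestEdge fs = EdgeIn (_∈ fs)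

  record PathCover (fs : List (Fin m)) (Ps : List (List V)) : Set where
    field
      paths-unique : All Unique Ps
      paths-disjoint : AllPairs Disjoint Ps
      paths-cover : ∀ w → Any (w ∈_) Ps
      paths-linked : All (Linked (ForestEdge fs)) Ps
      paths-count : length Ps + length fs ≡ n

  singletons : PathCover [] (map [_] (allFin n))
  singletons = record
    { paths-unique = AllP.map⁺ (All.tabulate (λ _ → [] ∷ []))
    ; paths-disjoint = APP.map⁺ (AP.map singletons-disjoint (UP.allFin⁺ n))
    ; paths-cover = λ w → AnyP.map⁺ (lose (∈-allFin w) (here refl))
    ; paths-linked = AllP.map⁺ (All.tabulate (λ _ → [-]))
    ; paths-count = trans (+-identityʳ _) (trans (length-map [_] (allFin n)) (length-tabulate (λ x → x)))
    }
    where
    singletons-disjoint : ∀ {x y : V} → x ≢ y → Disjoint [ x ] [ y ]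
    singletons-disjoint x≢y (here v≡x , here v≡y) = x≢y (trans (sym v≡x) v≡y)

  -- A third forest edge at an interior vertex of a forest path would form a triangle in L(G).
  interior-incidence-absurd : ∀ {fs f x} pre {a b post} → Unique (pre ++ a ∷ x ∷ b ∷ post) →
    Linked (ForestEdge fs) (pre ++ a ∷ x ∷ b ∷ post) → f ∉ fs → InF f → All InF fs → Incident f x → ⊥
  interior-incidence-absurd {fs} {f} {x} pre {a} {b} {post} u l f∉fs f∈F fs⊆F f∋x
    with Linked-middle pre l
       | Linked-middle (pre ++ [ a ]) (subst (Linked (ForestEdge fs)) (sym (++-assoc pre [ a ] (x ∷ b ∷ post))) l)
  ... | k₁ , k₁∈ , k₁-ax | k₂ , k₂∈ , k₂-xb =
    acyclic (f ∷ k₁ ∷ k₂ ∷ []) (s≤s (s≤s (s≤s z≤n)) , distinct , triangle)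
            (f∈F ∷ All.lookup fs⊆F k₁∈ ∷ All.lookup fs⊆F k₂∈ ∷ [])
    where
    f≢k₁ : f ≢ k₁
    f≢k₁ refl = f∉fs k₁∈
    f≢k₂ : f ≢ k₂
    f≢k₂ refl = f∉fs k₂∈
    k₁≢k₂ : k₁ ≢ k₂
    k₁≢k₂ refl with Incident-Joins k₂-xb (Joins⇒Incident₁ k₁-ax)
    ... | inj₁ a≡x = Unique[x∷xs]⇒x∉xs (Unique-++⁻ʳ pre u) (here a≡x)
    ... | inj₂ a≡b = Unique[x∷xs]⇒x∉xs (Unique-++⁻ʳ pre u) (there (here a≡b))
    distinct : Unique (f ∷ k₁ ∷ k₂ ∷ [])
    distinct = (f≢k₁ ∷ f≢k₂ ∷ []) ∷ (k₁≢k₂ ∷ []) ∷ [] ∷ []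
    triangle : Linked _∼ᴸ_ (f ∷ k₁ ∷ k₂ ∷ f ∷ [])
    triangle = ∼ᴸ-intro f≢k₁ f∋x (Joins⇒Incident₂ k₁-ax)
             ∷ ∼ᴸ-intro k₁≢k₂ (Joins⇒Incident₂ k₁-ax) (Joins⇒Incident₁ k₂-xb)
             ∷ ∼ᴸ-intro (f≢k₂ ∘ sym) (Joins⇒Incident₁ k₂-xb) f∋x ∷ [-]

  endpoint-view : ∀ {x} (P : List V) → x ∈ P → (∀ pre {a b post} → P ≡ pre ++ a ∷ x ∷ b ∷ post → ⊥) →
                  Σ (List V) (λ W → P ≡ x ∷ W) ⊎ Σ (List V) (λ W → P ≡ W ++ [ x ])
  endpoint-view {x} P x∈ notInterior with ∈-∃++ x∈
  ... | pre , post , P≡ with initLast pre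
  ...   | [] = inj₁ (post , P≡)
  ...   | pre′ ∷ʳ′ a with post
  ...     | [] = inj₂ (pre′ ++ [ a ] , P≡)
  ...     | b ∷ post′ = ⊥-elim (notInterior pre′ (trans P≡ (++-assoc pre′ [ a ] (x ∷ b ∷ post′))))

  EndingAt : List (Fin m) → V → List V → Set
  EndingAt fs x P = Σ (List V) (λ Q → Unique (Q ++ [ x ]) × Linked (ForestEdge fs) (Q ++ [ x ]) ×
                                      Q ++ [ x ] ⊆ P × P ⊆ Q ++ [ x ])

  endingAt : ∀ {fs x} P → Unique P → Linked (ForestEdge fs) P →
             Σ (List V) (λ W → P ≡ x ∷ W) ⊎ Σ (List V) (λ W → P ≡ W ++ [ x ]) → EndingAt fs x P
  endingAt P u l (inj₂ (W , refl)) = W , u , l , (λ w∈ → w∈) , (λ w∈ → w∈)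
  endingAt {fs} {x} P u l (inj₁ (W , refl)) =
    reverse W ,
    subst Unique rev≡ (Unique-reverse⁺ u) ,
    subst (Linked (ForestEdge fs)) rev≡ (Linked-reverse⁺ EdgeIn-sym l) ,
    (λ {w} w∈ → AnyP.reverse⁻ (subst (w ∈_) (sym rev≡) w∈)) ,
    (λ {w} w∈ → subst (w ∈_) rev≡ (AnyP.reverse⁺ w∈))
    where
    rev≡ : reverse (x ∷ W) ≡ reverse W ++ [ x ]
    rev≡ = unfold-reverse x W

  endingAt-incident : ∀ {fs f x} P → Unique P → Linked (ForestEdge fs) P → x ∈ P →
                      f ∉ fs → InF f → All InF fs → Incident f x → EndingAt fs x P
  endingAt-incident {fs} P u l x∈ f∉fs f∈F fs⊆F f∋x =
    endingAt P u l (endpoint-view P x∈ (λ pre P≡ →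
      interior-incidence-absurd pre (subst Unique P≡ u) (subst (Linked (ForestEdge fs)) P≡ l) f∉fs f∈F fs⊆F f∋x))

  ForestEdge-∷ : ∀ {f fs a b} → ForestEdge fs a b → ForestEdge (f ∷ fs) a b
  ForestEdge-∷ (k , k∈ , e) = k , there k∈ , e

  Linked-ForestEdge-∷ : ∀ {f fs P} → Linked (ForestEdge fs) P → Linked (ForestEdge (f ∷ fs)) P
  Linked-ForestEdge-∷ = Lk.map ForestEdge-∷

  closingEdge-absurd : ∀ {fs f u v} W → Unique (v ∷ W) → (l : Linked (ForestEdge fs) (v ∷ W)) →
    last (v ∷ W) ≡ just u → u ≢ v → Joins f u v → f ∉ fs → InF f → All InF fs → ⊥
  closingEdge-absurd [] _ _ refl u≢v _ _ _ _ = u≢v refl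
  closingEdge-absurd {fs} (w ∷ []) _ ((k , k∈ , k-vw) ∷ [-]) refl _ f-wv f∉fs _ _ =
    f∉fs (subst (_∈ fs) (Joins-injective k-vw (Joins-sym f-wv)) k∈)
  closingEdge-absurd {fs} {f} (w ∷ w′ ∷ W) u l@(r ∷ (r′ ∷ l′)) last≡u _ f-uv f∉fs f∈F fs⊆F =
    acyclic (edgesOf l ++ [ f ]) (length≥3 , distinct , closed)
            (AllP.++⁺ (All.map (All.lookup fs⊆F) (edgesOf-in l)) (f∈F ∷ []))
    where
    k₁ = proj₁ r
    length≥3 : 3 ≤ length (edgesOf l ++ [ f ])
    length≥3 = s≤s (s≤s (subst (1 ≤_) (sym (length-++-sucʳ (edgesOf l′) f [])) (s≤s z≤n)))
    f∉l : f ∉ edgesOf l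
    f∉l f∈ = f∉fs (All.lookup (edgesOf-in l) f∈)
    distinct : Unique (edgesOf l ++ [ f ])
    distinct = UP.++⁺ (edgesOf-unique u l) ([] ∷ []) (λ { (f∈ , here refl) → f∉l f∈ })
    open-walk : Linked _∼ᴸ_ (edgesOf l ++ [ f ])
    open-walk = edgesOf-closed u l f∉l (Joins⇒Incident₁ f-uv) last≡u (s≤s (s≤s z≤n))
    closed : Linked _∼ᴸ_ ((edgesOf l ++ [ f ]) ++ [ k₁ ])
    closed = subst (λ t → Linked _∼ᴸ_ (k₁ ∷ t)) (sym (++-assoc (edgesOf (r′ ∷ l′)) [ f ] [ k₁ ]))
      (Linked-∷ʳ (k₁ ∷ edgesOf (r′ ∷ l′)) open-walk
        (∼ᴸ-intro (λ f≡k₁ → f∉l (here f≡k₁)) (Joins⇒Incident₂ f-uv) (Joins⇒Incident₁ (proj₂ (proj₂ r)))))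

  joinsWithinPath-absurd : ∀ {fs f u v P} → EndingAt fs u P → v ∈ P → Joins f u v → u ≢ v →
                           f ∉ fs → InF f → All InF fs → ⊥
  joinsWithinPath-absurd {fs} {f} {u} {v} (Q , u-Q , l-Q , _ , P⊆) v∈ f-uv u≢v f∉fs f∈F fs⊆F
    with endpoint-view (Q ++ [ u ]) (P⊆ v∈) (λ pre P≡ →
           interior-incidence-absurd pre (subst Unique P≡ u-Q) (subst (Linked (ForestEdge fs)) P≡ l-Q)
             f∉fs f∈F fs⊆F (Joins⇒Incident₂ f-uv))
  ... | inj₂ (W , Q∷ʳu≡W∷ʳv) = u≢v (proj₂ (∷ʳ-injective Q W Q∷ʳu≡W∷ʳv))
  ... | inj₁ (W , Q∷ʳu≡v∷W) =
    closingEdge-absurd W (subst Unique Q∷ʳu≡v∷W u-Q) (subst (Linked (ForestEdge fs)) Q∷ʳu≡v∷W l-Q)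
      (trans (cong last (sym Q∷ʳu≡v∷W)) (last-∷ʳ Q u)) u≢v f-uv f∉fs f∈F fs⊆F

  record Merged (fs : List (Fin m)) (Pu Pv : List V) : Set where
    field
      path : List V
      unique : Unique path
      linked : Linked (ForestEdge fs) path
      ⊆Pu∪Pv : ∀ {w} → w ∈ path → w ∈ Pu ⊎ w ∈ Pv
      Pu⊆ : Pu ⊆ path
      Pv⊆ : Pv ⊆ path

  merge : ∀ {fs f u v Pu Pv} → EndingAt fs u Pu → EndingAt fs v Pv → Disjoint Pu Pv →
          ForestEdge (f ∷ fs) u v → Merged (f ∷ fs) Pu Pv
  merge {fs} {f} {u} {v} {Pu} {Pv} (Qu , u-Qu , l-Qu , Qu⊆ , ⊆Qu) (Qv , u-Qv , l-Qv , Qv⊆ , ⊆Qv) Pu#Pv uv =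
    record { path = M ; unique = unique ; linked = linked ; ⊆Pu∪Pv = ⊆Pu∪Pv ; Pu⊆ = Pu⊆ ; Pv⊆ = Pv⊆ }
    where
    M = Qu ++ u ∷ v ∷ reverse Qv
    M≡ : (Qu ++ [ u ]) ++ (v ∷ reverse Qv) ≡ M
    M≡ = ++-assoc Qu [ u ] (v ∷ reverse Qv)
    back⊆ : v ∷ reverse Qv ⊆ Pv
    back⊆ {w} w∈ = Qv⊆ (AnyP.reverse⁻ (subst (w ∈_) (sym (reverse-∷ʳ Qv v)) w∈))
    ⊆Pu∪Pv : ∀ {w} → w ∈ M → w ∈ Pu ⊎ w ∈ Pv
    ⊆Pu∪Pv {w} w∈ = Data.Sum.map Qu⊆ back⊆ (∈-++⁻ (Qu ++ [ u ]) (subst (w ∈_) (sym M≡) w∈))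
    unique : Unique M
    unique = subst Unique M≡ (UP.++⁺ u-Qu (subst Unique (reverse-∷ʳ Qv v) (Unique-reverse⁺ u-Qv))
                                     (λ (w∈Qu , w∈back) → Pu#Pv (Qu⊆ w∈Qu , back⊆ w∈back)))
    linked : Linked (ForestEdge (f ∷ fs)) M
    linked = Linked-join Qu (Linked-ForestEdge-∷ l-Qu)
      (uv ∷ subst (Linked (ForestEdge (f ∷ fs))) (reverse-∷ʳ Qv v) (Linked-reverse⁺ EdgeIn-sym (Linked-ForestEdge-∷ l-Qv)))
    Pu⊆ : Pu ⊆ M
    Pu⊆ {w} w∈ = subst (w ∈_) M≡ (∈-++⁺ˡ (⊆Qu w∈))
    Pv⊆ : Pv ⊆ M
    Pv⊆ {w} w∈ = subst (w ∈_) M≡ (∈-++⁺ʳ (Qu ++ [ u ]) (subst (w ∈_) (reverse-∷ʳ Qv v) (AnyP.reverse⁺ (⊆Qv w∈))))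

  joinPaths : ∀ {f fs Ps u v} (cover : PathCover fs Ps) (u∈ : Any (u ∈_) Ps) (v∈ : Any (v ∈_) (Ps Any.─ u∈)) →
              Joins f u v → f ∉ fs → InF f → All InF fs → Σ (List (List V)) (PathCover (f ∷ fs))
  joinPaths {f} {fs} {Ps} {u} {v} cover u∈ v∈ f-uv f∉fs f∈F fs⊆F =
    Merged.path merged ∷ Rest ,
    record { paths-unique = Merged.unique merged ∷ proj₂ (All-─ v∈ unique₁)
           ; paths-disjoint = merged#Rest ∷ proj₂ (AllPairs-─ Disjoint-sym v∈ disjoint₁)
           ; paths-cover = covers
           ; paths-linked = Merged.linked merged ∷ All.map Linked-ForestEdge-∷ (proj₂ (All-─ v∈ linked₁))
           ; paths-count = count }
    where
    open PathCover cover
    Pu = Any.lookup u∈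
    Pv = Any.lookup v∈
    Ps₁ = Ps Any.─ u∈
    Rest = Ps₁ Any.─ v∈
    unique₁ : All Unique Ps₁
    unique₁ = proj₂ (All-─ u∈ paths-unique)
    linked₁ : All (Linked (ForestEdge fs)) Ps₁
    linked₁ = proj₂ (All-─ u∈ paths-linked)
    Pu#Ps₁ : All (Disjoint Pu) Ps₁
    Pu#Ps₁ = proj₁ (AllPairs-─ Disjoint-sym u∈ paths-disjoint)
    disjoint₁ : AllPairs Disjoint Ps₁
    disjoint₁ = proj₂ (AllPairs-─ Disjoint-sym u∈ paths-disjoint)
    endingAt-u : EndingAt fs u Pu
    endingAt-u = endingAt-incident Pu (proj₁ (All-─ u∈ paths-unique)) (proj₁ (All-─ u∈ paths-linked))
                   (AnyP.lookup-result u∈) f∉fs f∈F fs⊆F (Joins⇒Incident₁ f-uv)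
    endingAt-v : EndingAt fs v Pv
    endingAt-v = endingAt-incident Pv (proj₁ (All-─ v∈ unique₁)) (proj₁ (All-─ v∈ linked₁))
                   (AnyP.lookup-result v∈) f∉fs f∈F fs⊆F (Joins⇒Incident₂ f-uv)
    merged : Merged (f ∷ fs) Pu Pv
    merged = merge endingAt-u endingAt-v (proj₁ (All-─ v∈ Pu#Ps₁)) (f , here refl , f-uv)
    merged#Rest : All (Disjoint (Merged.path merged)) Rest
    merged#Rest = All.zipWith merged# (proj₂ (All-─ v∈ Pu#Ps₁) , proj₁ (AllPairs-─ Disjoint-sym v∈ disjoint₁))
      where
      merged# : ∀ {P} → Disjoint Pu P × Disjoint Pv P → Disjoint (Merged.path merged) P
      merged# (Pu#P , Pv#P) = Disjoint-⊆∪ (Merged.⊆Pu∪Pv merged) Pu#P Pv#P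
    covers : ∀ w → Any (w ∈_) (Merged.path merged ∷ Rest)
    covers w = [ (λ w∈Pu → here (Merged.Pu⊆ merged w∈Pu)) ,
                 (λ w∈Ps₁ → [ (λ w∈Pv → here (Merged.Pv⊆ merged w∈Pv)) , there ]′ (Any-─ v∈ w∈Ps₁)) ]′
               (Any-─ u∈ (paths-cover w))
    count : suc (length Rest) + suc (length fs) ≡ n
    count = begin
      suc (length Rest) + suc (length fs)   ≡⟨ +-suc (suc (length Rest)) (length fs) ⟩
      suc (suc (length Rest)) + length fs   ≡⟨ cong (_+ length fs) (sym (trans (length-─ u∈) (cong suc (length-─ v∈)))) ⟩
      length Ps + length fs                 ≡⟨ paths-count ⟩
      n                                     ∎
      where open ≡-Reasoning

  addEdge : ∀ {f fs Ps u v} → Joins f u v → u ≢ v → f ∉ fs → InF f → All InF fs → PathCover fs Ps →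
            Σ (List (List V)) (PathCover (f ∷ fs))
  addEdge {f} {fs} {Ps} {u} {v} f-uv u≢v f∉fs f∈F fs⊆F cover
    with Any-─ (PathCover.paths-cover cover u) (PathCover.paths-cover cover v)
  ... | inj₁ v∈Pu = ⊥-elim (joinsWithinPath-absurd endingAt-u v∈Pu f-uv u≢v f∉fs f∈F fs⊆F)
    where
    open PathCover cover
    endingAt-u : EndingAt fs u (Any.lookup (paths-cover u))
    endingAt-u = endingAt-incident _ (proj₁ (All-─ (paths-cover u) paths-unique)) (proj₁ (All-─ (paths-cover u) paths-linked))
                   (AnyP.lookup-result (paths-cover u)) f∉fs f∈F fs⊆F (Joins⇒Incident₁ f-uv)
  ... | inj₂ v∈Rest = joinPaths cover (PathCover.paths-cover cover u) v∈Rest f-uv f∉fs f∈F fs⊆F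

  decompose : ∀ fs → Unique fs → All InF fs → Σ (List (List V)) (PathCover fs)
  decompose [] _ _ = _ , singletons
  decompose (f ∷ fs) u (f∈F ∷ fs⊆F) =
    addEdge {u = end₁ f} {v = end₂ f} (inj₁ (refl , refl)) (λ eq → ∼-irrefl (subst (end₁ f ∼_) (sym eq) (edge-∼ f)))
      (Unique[x∷xs]⇒x∉xs u) f∈F fs⊆F (proj₂ (decompose fs (Unique-tail u) fs⊆F))

module Paths {V : Set} (_≟_ : DecidableEquality V) (_∼_ : V → V → Set) (∼-sym : Symmetric _∼_) where
  open import Data.List.Membership.DecPropositional _≟_ using () renaming (_∈?_ to _∈ᵥ?_)

  SimplePath : List V → Set
  SimplePath xs = Unique xs × Linked _∼_ xs

  record Bridge (X Y : V → Set) : Set where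
    field
      src tgt : V
      via : List V
      src∈X : X src
      tgt∈Y : Y tgt
      unique : Unique (src ∷ via ++ [ tgt ])
      linked : Linked _∼_ (src ∷ via ++ [ tgt ])
      via∉X : All (¬_ ∘ X) via
      via∉Y : All (¬_ ∘ Y) via

  Bridge-map : ∀ {X Y X′ Y′ : V → Set} (c : Bridge X Y) → X′ (Bridge.src c) → Y′ (Bridge.tgt c) →
               (∀ {w} → X′ w → X w) → (∀ {w} → Y′ w → Y w) → Σ (Bridge X′ Y′) (λ c′ → Bridge.via c′ ≡ Bridge.via c)
  Bridge-map c src∈X′ tgt∈Y′ X′⊆X Y′⊆Y =
    record { Bridge c ; src∈X = src∈X′ ; tgt∈Y = tgt∈Y′
           ; via∉X = All.map (_∘ X′⊆X) (Bridge.via∉X c) ; via∉Y = All.map (_∘ Y′⊆Y) (Bridge.via∉Y c) } , refl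

  record PathInto (Y : V → Set) (w : V) : Set where
    field
      prefix : List V
      target : V
      target∈Y : Y target
      prefix∉Y : All (¬_ ∘ Y) prefix
      unique : Unique (prefix ++ [ target ])
      linked : Linked _∼_ (prefix ++ [ target ])
      starts : Σ (List V) (λ rest → prefix ++ [ target ] ≡ w ∷ rest)

  trivialPathInto : ∀ {Y w} → Y w → PathInto Y w
  trivialPathInto {w = w} w∈Y = record
    { prefix = [] ; target = w ; target∈Y = w∈Y ; prefix∉Y = [] ; unique = [] ∷ [] ; linked = [-] ; starts = [] , refl }

  -- Follow the walk; when it revisits a vertex of the path built so far, cut the loop out.
  pathInto : ∀ {Y} → (∀ w → Dec (Y w)) → ∀ {w b} → Star _∼_ w b → Y b → PathInto Y w
  pathInto Y? ε b∈Y = trivialPathInto b∈Y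
  pathInto {Y} Y? {w} (w∼ ◅ walk) b∈Y with Y? w
  ... | yes w∈Y = trivialPathInto w∈Y
  ... | no w∉Y with pathInto Y? walk b∈Y
  ...   | P with w ∈ᵥ? (PathInto.prefix P ++ [ PathInto.target P ])
  ...     | no w∉P = record
    { prefix = w ∷ prefix ; target = target ; target∈Y = target∈Y ; prefix∉Y = w∉Y ∷ prefix∉Y
    ; unique = Unique-∷⁺ w∉P unique
    ; linked = subst (λ t → Linked _∼_ (w ∷ t)) (sym (proj₂ starts)) (w∼ ∷ subst (Linked _∼_) (proj₂ starts) linked)
    ; starts = _ , refl }
    where open PathInto P
  ...     | yes w∈P with ∈-∃++ w∈P
  ...       | A , B , P≡A++w∷B with initLast B
  ...         | [] = ⊥-elim (w∉Y (subst Y (proj₂ (∷ʳ-injective (PathInto.prefix P) A P≡A++w∷B)) (PathInto.target∈Y P)))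
  ...         | B′ ∷ʳ′ t = record
    { prefix = w ∷ B′ ; target = target ; target∈Y = target∈Y
    ; prefix∉Y = w∉Y ∷ All.tail (AllP.++⁻ʳ A (subst (All (¬_ ∘ Y)) (proj₁ split) prefix∉Y))
    ; unique = subst (λ t → Unique (w ∷ B′ ++ [ t ])) (sym (proj₂ split)) (Unique-++⁻ʳ A (subst Unique P≡A++w∷B unique))
    ; linked = subst (λ t → Linked _∼_ (w ∷ B′ ++ [ t ])) (sym (proj₂ split))
                 (Linked-++⁻ʳ A (subst (Linked _∼_) P≡A++w∷B linked))
    ; starts = _ , refl }
    where
    open PathInto P
    split : prefix ≡ A ++ w ∷ B′ × target ≡ t
    split = ∷ʳ-injective prefix (A ++ w ∷ B′) (trans P≡A++w∷B (sym (++-assoc A (w ∷ B′) [ t ])))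

  -- The bridge starts at the last vertex of X on a path from a into Y.
  bridge : ∀ {X Y : V → Set} → (∀ w → Dec (X w)) → (∀ w → Dec (Y w)) → (∀ {w} → X w → Y w → ⊥) →
           ∀ {a b} → Star _∼_ a b → X a → Y b → Bridge X Y
  bridge {X} {Y} X? Y? X#Y walk a∈X b∈Y with pathInto Y? walk b∈Y
  ... | P with lastSatisfying X? {PathInto.prefix P ++ [ PathInto.target P ]}
                 (subst (Any X) (sym (proj₂ (PathInto.starts P))) (here a∈X))
  ... | L₁ , x , L₂ , P≡ , x∈X , L₂∉X with initLast L₂
  ... | [] = ⊥-elim (X#Y (subst X (sym (proj₂ (∷ʳ-injective (PathInto.prefix P) L₁ P≡))) x∈X) (PathInto.target∈Y P))
  ... | via ∷ʳ′ t = record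
    { src = x ; tgt = target ; via = via ; src∈X = x∈X ; tgt∈Y = target∈Y
    ; unique = subst (λ t → Unique (x ∷ via ++ [ t ])) (sym (proj₂ split)) (Unique-++⁻ʳ L₁ (subst Unique P≡ unique))
    ; linked = subst (λ t → Linked _∼_ (x ∷ via ++ [ t ])) (sym (proj₂ split)) (Linked-++⁻ʳ L₁ (subst (Linked _∼_) P≡ linked))
    ; via∉X = AllP.++⁻ˡ via L₂∉X
    ; via∉Y = All.tail (AllP.++⁻ʳ L₁ (subst (All (¬_ ∘ Y)) (proj₁ split) prefix∉Y)) }
    where
    open PathInto P
    split : prefix ≡ L₁ ++ x ∷ via × target ≡ t
    split = ∷ʳ-injective prefix (L₁ ++ x ∷ via) (trans P≡ (sym (++-assoc L₁ (x ∷ via) [ t ])))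

  longerHalf : ∀ {x} P → SimplePath P → x ∈ P →
    Σ (List V) (λ H → SimplePath (H ++ [ x ]) × H ++ [ x ] ⊆ P × suc (length P) ≤ suc (length H) + suc (length H))
  longerHalf {x} P (u , l) x∈ with ∈-∃++ x∈
  ... | pre , post , refl with length post ≤? length pre
  ... | yes post≤pre =
    pre , (Unique-++⁻ˡ (pre ++ [ x ]) (subst Unique (sym assoc) u) , Linked-++⁻ˡ (pre ++ [ x ]) (subst (Linked _∼_) (sym assoc) l)) ,
    (λ {w} w∈ → subst (w ∈_) assoc (∈-++⁺ˡ w∈)) ,
    subst (λ t → suc t ≤ suc (length pre) + suc (length pre)) (sym (length-++ pre))
      (s≤s (+-monoʳ-≤ (length pre) (s≤s post≤pre)))
    where
    assoc : (pre ++ [ x ]) ++ post ≡ pre ++ x ∷ post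
    assoc = ++-assoc pre [ x ] post
  ... | no post≰pre =
    reverse post ,
    (subst Unique (unfold-reverse x post) (Unique-reverse⁺ (Unique-++⁻ʳ pre u)) ,
     subst (Linked _∼_) (unfold-reverse x post) (Linked-reverse⁺ ∼-sym (Linked-++⁻ʳ pre l))) ,
    (λ {w} w∈ → ∈-++⁺ʳ pre (AnyP.reverse⁻ (subst (w ∈_) (sym (unfold-reverse x post)) w∈))) ,
    subst₂ (λ t t′ → suc t ≤ suc t′ + suc t′) (sym (length-++ pre)) (sym (length-reverse post))
      (s≤s (+-monoˡ-≤ (suc (length post)) (<⇒≤ (≰⇒> post≰pre))))

  segment : ∀ {x y} P → SimplePath P → x ∈ P → y ∈ P →
    Σ (List V) (λ Sg → Σ (List V) (λ T → Σ (List V) (λ U →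
      Sg ≡ x ∷ T × Sg ≡ U ++ [ y ] × SimplePath Sg × Sg ⊆ P)))
  segment {x} {y} P (u , l) x∈ y∈ with ∈-∃++ x∈
  ... | A , B , refl with ∈-++⁻ A y∈
  ... | inj₂ (here refl) = [ x ] , [] , [] , refl , refl , ([] ∷ [] , [-]) , (λ { (here refl) → ∈-++⁺ʳ A (here refl) })
  ... | inj₂ (there y∈B) with ∈-∃++ y∈B
  ...   | B₁ , B₂ , refl =
    x ∷ B₁ ++ [ y ] , B₁ ++ [ y ] , x ∷ B₁ , refl , refl ,
    (Unique-++⁻ˡ (x ∷ B₁ ++ [ y ]) (Unique-++⁻ʳ A (subst Unique P≡ u)) ,
     Linked-++⁻ˡ (x ∷ B₁ ++ [ y ]) (Linked-++⁻ʳ A (subst (Linked _∼_) P≡ l))) ,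
    (λ w∈ → subst (_ ∈_) (sym P≡) (∈-++⁺ʳ A (∈-++⁺ˡ w∈)))
    where
    P≡ : A ++ x ∷ (B₁ ++ y ∷ B₂) ≡ A ++ (x ∷ B₁ ++ [ y ]) ++ B₂
    P≡ = cong (A ++_) (sym (++-assoc (x ∷ B₁) [ y ] B₂))
  segment {x} {y} P (u , l) x∈ y∈ | A , B , refl | inj₁ y∈A with ∈-∃++ y∈A
  ...   | A₁ , A₂ , refl =
    x ∷ (reverse A₂ ++ [ y ]) , reverse A₂ ++ [ y ] , x ∷ reverse A₂ , refl , refl ,
    (subst Unique rev≡ (Unique-reverse⁺ (Unique-++⁻ˡ (y ∷ A₂ ++ [ x ]) (Unique-++⁻ʳ A₁ (subst Unique P≡ u)))) ,
     subst (Linked _∼_) rev≡ (Linked-reverse⁺ ∼-sym (Linked-++⁻ˡ (y ∷ A₂ ++ [ x ]) (Linked-++⁻ʳ A₁ (subst (Linked _∼_) P≡ l))))) ,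
    (λ {w} w∈ → subst (w ∈_) (sym P≡) (∈-++⁺ʳ A₁ (∈-++⁺ˡ {xs = y ∷ A₂ ++ [ x ]}
                  (AnyP.reverse⁻ {xs = y ∷ A₂ ++ [ x ]} (subst (w ∈_) (sym rev≡) w∈)))))
    where
    P≡ : (A₁ ++ y ∷ A₂) ++ x ∷ B ≡ A₁ ++ (y ∷ A₂ ++ [ x ]) ++ B
    P≡ = trans (++-assoc A₁ (y ∷ A₂) (x ∷ B)) (cong (A₁ ++_) (sym (++-assoc (y ∷ A₂) [ x ] B)))
    rev≡ : reverse (y ∷ A₂ ++ [ x ]) ≡ x ∷ (reverse A₂ ++ [ y ])
    rev≡ = trans (reverse-∷ʳ (y ∷ A₂) x) (cong (x ∷_) (unfold-reverse y A₂))

  module LongestPath (p : ℕ) (longest : ∀ {xs} → SimplePath xs → length xs ≤ suc p)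
                     (connected : ∀ u v → Star _∼_ u v) where

    -- hP and hQ count the vertices of the longer halves of P and Q, at either end of a joining
    -- path with t inner vertices; the glued path has hP + t + hQ vertices.
    JoinedHalves : List V → List V → ℕ → Set
    JoinedHalves P Q t = Σ ℕ (λ hP → Σ ℕ (λ hQ →
      suc (length P) ≤ hP + hP × suc (length Q) ≤ hQ + hQ × hP + t + hQ ≤ suc p))

    JoinedHalves-weaken : ∀ {P Q t} → 1 ≤ t → JoinedHalves P Q t → JoinedHalves P Q 1
    JoinedHalves-weaken 1≤t (hP , hQ , bP , bQ , b) = hP , hQ , bP , bQ , ≤-trans (+-monoˡ-≤ hQ (+-monoʳ-≤ hP 1≤t)) b

    JoinedHalves-sym : ∀ {P Q t} → JoinedHalves P Q t → JoinedHalves Q P t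
    JoinedHalves-sym {t = t} (hP , hQ , bP , bQ , b) =
      hQ , hP , bQ , bP , subst (_≤ suc p) (rearrange hP t hQ) b
      where
      rearrange : ∀ hP t hQ → hP + t + hQ ≡ hQ + t + hP
      rearrange = solve-∀

    joinHalves : ∀ {P Q} → SimplePath P → SimplePath Q → Disjoint P Q →
                 (c : Bridge (_∈ P) (_∈ Q)) → JoinedHalves P Q (length (Bridge.via c))
    joinHalves {P} {Q} pathP pathQ P#Q c with longerHalf P pathP (Bridge.src∈X c) | longerHalf Q pathQ (Bridge.tgt∈Y c)
    ... | HP , (u-HP , l-HP) , HP⊆ , boundP | HQ , (u-HQ , l-HQ) , HQ⊆ , boundQ =
      suc (length HP) , suc (length HQ) , boundP , boundQ ,
      subst (_≤ suc p) (trans length-Z (rearrange (length HP) (length via) (length HQ))) (longest (u-Z , l-Z))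
      where
      open Bridge c
      Z = HP ++ src ∷ (via ++ (tgt ∷ reverse HQ))
      rearrange : ∀ a i b → a + suc (i + suc b) ≡ suc a + i + suc b
      rearrange = solve-∀
      u-back : Unique (tgt ∷ reverse HQ)
      u-back = subst Unique (reverse-∷ʳ HQ tgt) (Unique-reverse⁺ u-HQ)
      l-back : Linked _∼_ (tgt ∷ reverse HQ)
      l-back = subst (Linked _∼_) (reverse-∷ʳ HQ tgt) (Linked-reverse⁺ ∼-sym l-HQ)
      back⊆Q : tgt ∷ reverse HQ ⊆ Q
      back⊆Q {w} w∈ = HQ⊆ (AnyP.reverse⁻ (subst (w ∈_) (sym (reverse-∷ʳ HQ tgt)) w∈))
      u-tail : Unique (via ++ (tgt ∷ reverse HQ))
      u-tail = UP.++⁺ (Unique-++⁻ˡ via (Unique-tail unique)) u-back (λ (w∈via , w∈back) → All.lookup via∉Y w∈via (back⊆Q w∈back))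
      u-Z : Unique Z
      u-Z = subst Unique (++-assoc HP [ src ] (via ++ (tgt ∷ reverse HQ))) (UP.++⁺ u-HP u-tail front#tail)
        where
        front#tail : Disjoint (HP ++ [ src ]) (via ++ (tgt ∷ reverse HQ))
        front#tail (w∈front , w∈tail) =
          [ (λ w∈via → All.lookup via∉X w∈via (HP⊆ w∈front)) , (λ w∈back → P#Q (HP⊆ w∈front , back⊆Q w∈back)) ]′
          (∈-++⁻ via w∈tail)
      l-Z : Linked _∼_ Z
      l-Z = Linked-join HP l-HP (Linked-join (src ∷ via) linked l-back)
      length-Z : length Z ≡ length HP + suc (length via + suc (length HQ))
      length-Z = trans (length-++ HP) (cong (λ t → length HP + suc t)
                   (trans (length-++ via) (cong (λ t → length via + suc t) (length-reverse HQ))))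

    joinHalvesOf : ∀ {X Y} → SimplePath X → SimplePath Y → Disjoint X Y → ∀ {a b} → a ∈ X → b ∈ Y →
                   Σ ℕ (JoinedHalves X Y)
    joinHalvesOf {X} {Y} pathX pathY X#Y a∈X b∈Y =
      _ , joinHalves pathX pathY X#Y (bridge (_∈ᵥ? X) (_∈ᵥ? Y) (λ w∈X w∈Y → X#Y (w∈X , w∈Y)) (connected _ _) a∈X b∈Y)

    -- A bridge from R that lands on P at z continues along P to x and crosses the edge x ∼ y into Q.
    detour : ∀ {R P Q x y} → SimplePath R → SimplePath P → SimplePath Q →
             Disjoint R P → Disjoint R Q → Disjoint P Q →
             (c : Bridge (_∈ R) ((_∈ P) ∪ (_∈ Q))) → Bridge.tgt c ∈ P →
             x ∈ P → y ∈ Q → x ∼ y → JoinedHalves R Q 1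
    detour {R} {P} {Q} {x} {y} pathR pathP pathQ R#P R#Q P#Q c z∈P x∈P y∈Q x∼y
      with segment P pathP z∈P x∈P
    ... | Sg , T , U , Sg≡z∷T , Sg≡U∷ʳx , (u-Sg , l-Sg) , Sg⊆P =
      JoinedHalves-weaken {R} {Q} 1≤|via′| (joinHalves pathR pathQ R#Q c′)
      where
      open Bridge c
      via′≡ : (via ++ Sg) ++ [ y ] ≡ via ++ tgt ∷ (T ++ [ y ])
      via′≡ = trans (++-assoc via Sg [ y ]) (cong (λ t → via ++ t ++ [ y ]) Sg≡z∷T)
      l-Sg∷ʳy : Linked _∼_ (Sg ++ [ y ])
      l-Sg∷ʳy = subst (λ t → Linked _∼_ (t ++ [ y ])) (sym Sg≡U∷ʳx)
                  (subst (Linked _∼_) (sym (++-assoc U [ x ] [ y ])) (Linked-∷ʳ U (subst (Linked _∼_) Sg≡U∷ʳx l-Sg) x∼y))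
      u-Sg∷ʳy : Unique (Sg ++ [ y ])
      u-Sg∷ʳy = UP.++⁺ u-Sg ([] ∷ []) (λ { (w∈Sg , here refl) → P#Q (Sg⊆P w∈Sg , y∈Q) })
      start#rest : Disjoint (src ∷ via) (Sg ++ [ y ])
      start#rest (here refl , w∈) =
        [ (λ w∈Sg → R#P (src∈X , Sg⊆P w∈Sg)) , (λ { (here w≡y) → R#Q (src∈X , subst (_∈ Q) (sym w≡y) y∈Q) }) ]′
        (∈-++⁻ Sg w∈)
      start#rest (there w∈via , w∈) =
        [ (λ w∈Sg → All.lookup via∉Y w∈via (inj₁ (Sg⊆P w∈Sg))) ,
          (λ { (here w≡y) → All.lookup via∉Y w∈via (inj₂ (subst (_∈ Q) (sym w≡y) y∈Q)) }) ]′
        (∈-++⁻ Sg w∈)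
      c′ : Bridge (_∈ R) (_∈ Q)
      c′ = record
        { src = src ; tgt = y ; via = via ++ Sg ; src∈X = src∈X ; tgt∈Y = y∈Q
        ; unique = subst (λ t → Unique (src ∷ t)) (sym (++-assoc via Sg [ y ]))
                     (UP.++⁺ (Unique-++⁻ˡ (src ∷ via) unique) u-Sg∷ʳy start#rest)
        ; linked = subst (λ t → Linked _∼_ (src ∷ t)) (sym via′≡)
                     (Linked-join (src ∷ via) linked (subst (λ t → Linked _∼_ (t ++ [ y ])) Sg≡z∷T l-Sg∷ʳy))
        ; via∉X = AllP.++⁺ via∉X (All.tabulate (λ w∈Sg w∈R → R#P (w∈R , Sg⊆P w∈Sg)))
        ; via∉Y = AllP.++⁺ (All.map (_∘ inj₂) via∉Y) (All.tabulate (λ w∈Sg w∈Q → P#Q (Sg⊆P w∈Sg , w∈Q))) }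
      1≤|via′| : 1 ≤ length (via ++ Sg)
      1≤|via′| = subst (1 ≤_) (sym (length-++ via))
        (subst (λ t → 1 ≤ length via + length t) (sym Sg≡z∷T) (subst (1 ≤_) (sym (+-suc (length via) (length T))) (s≤s z≤n)))

    twoOfThreeJoined-landingInQ : ∀ {P Q R} → SimplePath P → SimplePath Q → SimplePath R →
      Disjoint P Q → Disjoint P R → Disjoint Q R → ∀ {r} → r ∈ R →
      (c : Bridge (_∈ P) ((_∈ Q) ∪ (_∈ R))) → Bridge.tgt c ∈ Q →
      JoinedHalves P Q 1 ⊎ JoinedHalves R Q 1 ⊎ JoinedHalves R P 1
    twoOfThreeJoined-landingInQ {P} {Q} {R} pathP pathQ pathR P#Q P#R Q#R {r} r∈R c tgt∈Q with Bridge.via c in via≡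
    ... | _ ∷ _ with Bridge-map {X′ = _∈ P} {Y′ = _∈ Q} c (Bridge.src∈X c) tgt∈Q (λ w∈ → w∈) inj₁
    ...   | c′ , via′≡ = inj₁ (JoinedHalves-weaken {P} {Q} (subst (1 ≤_) (cong length (sym (trans via′≡ via≡))) (s≤s z≤n))
                                                 (joinHalves pathP pathQ P#Q c′))
    twoOfThreeJoined-landingInQ {P} {Q} {R} pathP pathQ pathR P#Q P#R Q#R {r} r∈R c tgt∈Q | []
      with bridge {X = _∈ R} {Y = (_∈ P) ∪ (_∈ Q)} (_∈ᵥ? R) (λ w → (w ∈ᵥ? P) ⊎-dec (w ∈ᵥ? Q))
             (λ { w∈R (inj₁ w∈P) → P#R (w∈P , w∈R) ; w∈R (inj₂ w∈Q) → Q#R (w∈Q , w∈R) })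
             (connected r (Bridge.src c)) r∈R (inj₁ (Bridge.src∈X c))
    ... | c₂ with Bridge.tgt∈Y c₂
    ...   | inj₁ z∈P = inj₂ (inj₁ (detour pathR pathP pathQ (Disjoint-sym P#R) (Disjoint-sym Q#R) P#Q c₂ z∈P (Bridge.src∈X c) tgt∈Q edge))
      where
      edge : Bridge.src c ∼ Bridge.tgt c
      edge = Lk.head (subst (λ t → Linked _∼_ (Bridge.src c ∷ t ++ [ Bridge.tgt c ])) via≡ (Bridge.linked c))
    ...   | inj₂ z∈Q = inj₂ (inj₂ (detour pathR pathQ pathP (Disjoint-sym Q#R) (Disjoint-sym P#R) (Disjoint-sym P#Q)
                   (proj₁ (Bridge-map {X′ = _∈ R} {Y′ = (_∈ Q) ∪ (_∈ P)} c₂ (Bridge.src∈X c₂) (inj₁ z∈Q) (λ w∈ → w∈) Data.Sum.swap))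
                   z∈Q tgt∈Q (Bridge.src∈X c) (∼-sym edge)))
      where
      edge : Bridge.src c ∼ Bridge.tgt c
      edge = Lk.head (subst (λ t → Linked _∼_ (Bridge.src c ∷ t ++ [ Bridge.tgt c ])) via≡ (Bridge.linked c))

    twoOfThreeJoined : ∀ {P Q R} → SimplePath P → SimplePath Q → SimplePath R →
      Disjoint P Q → Disjoint P R → Disjoint Q R → ∀ {a b r} → a ∈ P → b ∈ Q → r ∈ R →
      JoinedHalves P Q 1 ⊎ JoinedHalves P R 1 ⊎ JoinedHalves Q R 1
    twoOfThreeJoined {P} {Q} {R} pathP pathQ pathR P#Q P#R Q#R {a} {b} {r} a∈P b∈Q r∈R
      with bridge {X = _∈ P} {Y = (_∈ Q) ∪ (_∈ R)} (_∈ᵥ? P) (λ w → (w ∈ᵥ? Q) ⊎-dec (w ∈ᵥ? R))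
             (λ { w∈P (inj₁ w∈Q) → P#Q (w∈P , w∈Q) ; w∈P (inj₂ w∈R) → P#R (w∈P , w∈R) }) (connected a b) a∈P (inj₁ b∈Q)
    ... | c with Bridge.tgt∈Y c
    ...   | inj₁ tgt∈Q with twoOfThreeJoined-landingInQ pathP pathQ pathR P#Q P#R Q#R r∈R c tgt∈Q
    ...     | inj₁ PQ = inj₁ PQ
    ...     | inj₂ (inj₁ RQ) = inj₂ (inj₂ (JoinedHalves-sym {R} {Q} RQ))
    ...     | inj₂ (inj₂ RP) = inj₂ (inj₁ (JoinedHalves-sym {R} {P} RP))
    twoOfThreeJoined {P} {Q} {R} pathP pathQ pathR P#Q P#R Q#R {a} {b} {r} a∈P b∈Q r∈R | c | inj₂ tgt∈R
      with twoOfThreeJoined-landingInQ pathP pathR pathQ P#R P#Q (Disjoint-sym Q#R) b∈Q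
             (proj₁ (Bridge-map {X′ = _∈ P} {Y′ = (_∈ R) ∪ (_∈ Q)} c (Bridge.src∈X c) (inj₁ tgt∈R) (λ w∈ → w∈) Data.Sum.swap)) tgt∈R
    ...     | inj₁ PR = inj₂ (inj₁ PR)
    ...     | inj₂ (inj₁ QR) = inj₂ (inj₂ QR)
    ...     | inj₂ (inj₂ QP) = inj₁ (JoinedHalves-sym {Q} {P} QP)

    head∈ : ∀ {c} {X : List V} → c < length X → Σ V (_∈ X)
    head∈ {X = x ∷ _} _ = x , here refl

    vertexCount-even : ∀ {c} → suc c ≡ p → Σ ℕ (λ r → p ≡ r + r) → ∀ Ps → All SimplePath Ps → AllPairs Disjoint Ps →
                       sum (map length Ps) ≤ c * length Ps + 2
    vertexCount-even {c} 1+c≡p (r , p≡r+r) Ps paths disjoint =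
      subst (λ k → sum (map length Ps) ≤ c * k + 2) (length-map length Ps)
        (sum≤*length+-atMostOneAbove c 2 (map length Ps)
          (APP.map⁺ (AP.map notBothLong (AllPairs-withAll paths disjoint)))
          (AllP.map⁺ (All.map (λ {X} path _ → subst (length X ≤_) 1+p≡c+2 (longest path)) paths)))
      where
      1+p≡c+2 : suc p ≡ c + 2
      1+p≡c+2 = trans (cong suc (sym 1+c≡p)) (+-comm 2 c)
      notBothLong : ∀ {X Y} → SimplePath X × SimplePath Y × Disjoint X Y → ¬ (c < length X × c < length Y)
      notBothLong {X} {Y} (pathX , pathY , X#Y) (c<X , c<Y) =
        absurd (joinHalvesOf pathX pathY X#Y (proj₂ (head∈ c<X)) (proj₂ (head∈ c<Y)))
        where
        absurd : Σ ℕ (JoinedHalves X Y) → ⊥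
        absurd (t , hX , hY , bX , bY , b) =
          even-longPair-absurd r hX hY t (length X) (length Y) bX bY (subst (λ z → hX + t + hY ≤ suc z) p≡r+r b)
            (subst (_≤ length X) (trans 1+c≡p p≡r+r) c<X) (subst (_≤ length Y) (trans 1+c≡p p≡r+r) c<Y)

    vertexCount-odd : ∀ {c} → suc (suc c) ≡ p → Σ ℕ (λ r → p ≡ suc (r + r)) → ∀ Ps → All SimplePath Ps → AllPairs Disjoint Ps →
                      sum (map length Ps) ≤ c * length Ps + 4
    vertexCount-odd {c} 2+c≡p (r , p≡1+r+r) Ps paths disjoint =
      subst (λ k → sum (map length Ps) ≤ c * k + 4) (length-map length Ps)
        (sum≤*length+4-atMostTwoAbove c (map length Ps)
          (APP.map⁺ (AP.map longPair (AllPairs-withAll paths disjoint)))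
          (AllTriples-map⁺ length Ps (AllTriples-fromPairs notThreeLong paths disjoint))
          (AllP.map⁺ (All.map (λ {X} path → subst (length X ≤_) 1+p≡c+3 (longest path)) paths)))
      where
      1+p≡c+3 : suc p ≡ c + 3
      1+p≡c+3 = trans (cong suc (sym 2+c≡p)) (+-comm 3 c)
      1+r+r≡c+2 : suc (r + r) ≡ c + 2
      1+r+r≡c+2 = trans (sym p≡1+r+r) (trans (sym 2+c≡p) (+-comm 2 c))
      long : ∀ {L} → c < L → r + r ≤ L
      long {L} c<L = subst (_≤ L) (suc-injective (trans 2+c≡p p≡1+r+r)) c<L
      bound : ∀ hX t hY → hX + t + hY ≤ suc p → hX + t + hY ≤ suc (suc (r + r))
      bound hX t hY = subst (λ z → hX + t + hY ≤ suc z) p≡1+r+r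
      longPair : ∀ {X Y} → SimplePath X × SimplePath Y × Disjoint X Y → c < length X → c < length Y →
                 length X ≤ c + 2 × length Y ≤ c + 2
      longPair {X} {Y} (pathX , pathY , X#Y) c<X c<Y =
        bounds (joinHalvesOf pathX pathY X#Y (proj₂ (head∈ c<X)) (proj₂ (head∈ c<Y)))
        where
        bounds : Σ ℕ (JoinedHalves X Y) → length X ≤ c + 2 × length Y ≤ c + 2
        bounds (t , hX , hY , bX , bY , b) =
          subst (length X ≤_) 1+r+r≡c+2 (odd-longPair-bound r hX hY t _ _ bX bY (bound hX t hY b) (long c<X) (long c<Y)) ,
          subst (length Y ≤_) 1+r+r≡c+2 (odd-longPair-bound r hY hX t _ _ bY bX (bound hY t hX b′) (long c<Y) (long c<X))
          where
          b′ : hY + t + hX ≤ suc p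
          b′ = subst (_≤ suc p) (rearrange hX t hY) b
            where
            rearrange : ∀ hP t hQ → hP + t + hQ ≡ hQ + t + hP
            rearrange = solve-∀
      notThreeLong : ∀ {X Y Z} → SimplePath X → SimplePath Y → SimplePath Z → Disjoint X Y → Disjoint X Z → Disjoint Y Z →
                     c < length X → c < length Y → c < length Z → ⊥
      notThreeLong {X} {Y} {Z} pathX pathY pathZ X#Y X#Z Y#Z c<X c<Y c<Z =
        [ absurd {X} {Y} c<X c<Y , [ absurd {X} {Z} c<X c<Z , absurd {Y} {Z} c<Y c<Z ]′ ]′
        (twoOfThreeJoined pathX pathY pathZ X#Y X#Z Y#Z (proj₂ (head∈ c<X)) (proj₂ (head∈ c<Y)) (proj₂ (head∈ c<Z)))
        where
        absurd : ∀ {A B} → c < length A → c < length B → JoinedHalves A B 1 → ⊥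
        absurd c<A c<B (hA , hB , bA , bB , b) =
          odd-longPairWithInterior-absurd r hA hB _ _ bA bB (bound hA 1 hB b) (long c<A) (long c<B)

module Bounds {n : ℕ} (G : SimpleGraph n) (connected : Connected (toGraph G))
              {p : ℕ} (longest : LongestPathLength (toGraph G) p) where
  open LineGraphOf G
  open UpperBound G
  open Paths FP._≟_ _∼_ ∼-sym

  simplePath-length≤ : ∀ {xs} → SimplePath xs → length xs ≤ suc p
  simplePath-length≤ {[]} _ = z≤n
  simplePath-length≤ {x ∷ xs} (u , l) = s≤s (proj₂ longest (x ∷ xs) (length xs) (refl , u , l))

  open LongestPath p simplePath-length≤ connected public

  upperBound : Σ ℕ (λ d → IsDecyclingNumber L d × d ≤ m ∸ p)
  upperBound = fromDecyclingSet (complementOfPath-decycling (proj₁ (proj₁ longest)) (proj₂ (proj₁ longest)))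
    where
    fromDecyclingSet : Σ (List (Fin m)) (λ S₀ → IsDecyclingSet L S₀ × length S₀ ≡ m ∸ p) →
                       Σ ℕ (λ d → IsDecyclingNumber L d × d ≤ m ∸ p)
    fromDecyclingSet (S₀ , S₀-decycling , |S₀|≡m∸p) =
      Data.Product.map₂ (Data.Product.map₂ (λ d≤|S₀| → subst (_ ≤_) |S₀|≡m∸p d≤|S₀|)) (decyclingNumber S₀ S₀-decycling)

  PathCoverOutside : List (Fin m) → Set
  PathCoverOutside S = Σ (List (List V)) (λ Ps → Σ ℕ (λ f →
    All SimplePath Ps × AllPairs Disjoint Ps × length Ps + f ≡ n × n ≤ sum (map length Ps) × m ≤ length S + f))

  decyclingSet⇒pathCover : ∀ S → IsDecyclingSet L S → PathCoverOutside S
  decyclingSet⇒pathCover S (S-unique , acyclic) =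
    Ps , length F , paths , paths-disjoint , paths-count , n≤sum , ≤-reflexive (sym (length-complement S-unique))
    where
    open LinearForest G (_∉ S) (λ cs cyc avoids → acyclic (cs , cyc , avoids))
    F = complement S
    cover = decompose F (complement-unique S) (All.tabulate ∈-complement⁻)
    Ps = proj₁ cover
    open PathCover (proj₂ cover)
    paths : All SimplePath Ps
    paths = All.zipWith (λ (u , l) → u , Lk.map (λ (_ , _ , joins) → Joins⇒∼ joins) l) (paths-unique , paths-linked)
    n≤sum : n ≤ sum (map length Ps)
    n≤sum = subst₂ _≤_ (length-tabulate (λ x → x)) (length-concat Ps)
              (Unique-⊆⇒length≤ (UP.allFin⁺ n) (λ {v} _ → ∈-concat⁺ (paths-cover v)))

  lowerBound : ∀ {d} → IsDecyclingNumber L d → ∀ c e →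
    (∀ Ps → All SimplePath Ps → AllPairs Disjoint Ps → sum (map length Ps) ≤ suc c * length Ps + e) →
    m ∸ (c * n + e) / suc c ≤ d
  lowerBound ((S , S-decycling , |S|≡d) , _) c e vertexCount = fromCover (decyclingSet⇒pathCover S S-decycling)
    where
    fromCover : PathCoverOutside S → m ∸ (c * n + e) / suc c ≤ _
    fromCover (Ps , f , paths , disjoint , k+f≡n , n≤sum , m≤|S|+f) =
      subst (m ∸ (c * n + e) / suc c ≤_) |S|≡d
        (lowerBound-arithmetic c e k+f≡n (≤-trans n≤sum (vertexCount Ps paths disjoint)) m≤|S|+f)

mainTheorem5 : ∀ (n : ℕ) (G : SimpleGraph n) (p : ℕ) →
    Connected (toGraph G) → LongestPathLength (toGraph G) p → 4 ≤ p →
    Σ ℕ (λ d → IsDecyclingNumber (LineGraph G) d ×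
      ((2 ∣ p → (numEdges G ∸ floorDiv ((p ∸ 2) * n + 2) (p ∸ 1) ≤ d) × (d ≤ numEdges G ∸ p)) ×
       (¬ (2 ∣ p) → (numEdges G ∸ floorDiv ((p ∸ 3) * n + 4) (p ∸ 2) ≤ d) × (d ≤ numEdges G ∸ p))))
mainTheorem5 n G p connected longest (s≤s (s≤s (s≤s (s≤s (z≤n {q}))))) =
  let d , isNumber , d≤m∸p = upperBound in
  d , isNumber ,
  (λ 2∣p → lowerBound isNumber (2 + q) 2 (vertexCount-even refl (2∣⇒even 2∣p)) , d≤m∸p) ,
  (λ 2∤p → lowerBound isNumber (1 + q) 4 (vertexCount-odd refl (¬2∣⇒odd p 2∤p)) , d≤m∸p)
  where open Bounds G connected longest
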